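{- Let $n,k$ be positive integers, $r \in \{1,\dots,k\}$, $t$ an integer with $k < t \le n-k$, and consider SINGLE-REF with parameters $t$ and $r$. Let $v_d$ be an item with $d \le r$ and let $j \in \{0,1,\dots,k-1\}$. Then the probability $p_d^{(j+1)}$ that SINGLE-REF accepts $v_d$ as its $(j+1)$-th accepted item equals \[ p_d^{(j+1)} = \frac{\kappa \tau}{n} \sum_{i=t+j}^{n} \binom{i-t}{j} \frac{1}{(i-1)^{\underline{r+j}}}, \] where $\kappa = (r-1+j)^{\underline{j}}$ and $\tau = (t-1)^{\underline{r}}$.
   Context: For integers $a \ge b \ge 0$, $a^{\underline{b}} = a!/(a-b)!$ denotes the falling factorial. $k$-secretary problem: $n$ items with distinct values $v_1 > \dots > v_n$ arrive in a uniformly random order; at most $k$ may be accepted, each decision immediately and irrevocably on arrival. SINGLE-REF with parameters $t$ (sampling threshold) and $r$ (reference rank): reject the first $t-1$ items; let $s_r$ be the $r$-th best among them; then accept the first $k$ items that are better than $s_r$. -}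

module Defs where

open import Data.Nat.Base using (ℕ; zero; suc; _+_; _*_; _∸_; _<ᵇ_; _!)
open import Data.Bool.Base using (Bool; true; false; if_then_else_)
open import Data.List.Base using (List; []; _∷_; map; concatMap; take; drop; filter; upTo)
open import Data.Maybe.Base using (Maybe; just; nothing)
open import Data.Integer.Base using (+_)
open import Data.Rational.Base using (ℚ; 0ℚ; _/_) renaming (_+_ to _+ℚ_)
import Relation.Nullary.Decidable
open import Data.Nat.Properties using (_<?_; _≟_)
import Data.Maybe.Properties as MP

fall : ℕ → ℕ → ℕ
fall a zero = 1
fall a (suc b) = a * fall (a ∸ 1) b

-- a / b as a rational number (b = 0 is never used; mapped to 0)
_÷ℕ_ : ℕ → ℕ → ℚ
a ÷ℕ zero = 0ℚ
a ÷ℕ suc b = (+ a) / suc b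

-- Σ_{i = lo}^{hi} f i, computed as Σ_{m=0}^{hi-lo} f (lo + m) (empty if hi < lo)
sumQ : (ℕ → ℚ) → ℕ → ℕ → ℚ
sumQ f lo hi = go (suc hi ∸ lo)
  where
  go : ℕ → ℚ
  go zero = 0ℚ
  go (suc m) = go m +ℚ f (lo + m)

insertAll : ℕ → List ℕ → List (List ℕ)
insertAll x [] = (x ∷ []) ∷ []
insertAll x (y ∷ ys) = (x ∷ y ∷ ys) ∷ map (y ∷_) (insertAll x ys)

perms : List ℕ → List (List ℕ)
perms [] = [] ∷ []
perms (x ∷ xs) = concatMap (insertAll x) (perms xs)

-- Items are identified by their rank: item v_d has rank d (1 = best).
-- An arrival order is a permutation of [1, ..., n]; entry p is the p-th arriving item.
arrivalOrders : ℕ → List (List ℕ)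
arrivalOrders n = perms (map suc (upTo n))

ins : ℕ → List ℕ → List ℕ
ins x [] = x ∷ []
ins x (y ∷ ys) = if y <ᵇ x then y ∷ ins x ys else x ∷ y ∷ ys

sort : List ℕ → List ℕ
sort [] = []
sort (x ∷ xs) = ins x (sort xs)

nth : ℕ → List ℕ → Maybe ℕ
nth _ [] = nothing
nth zero (x ∷ xs) = just x
nth (suc i) (x ∷ xs) = nth i xs

-- rank of the r-th best item among a list (r ≥ 1); 0 if it does not exist
rthBest : ℕ → List ℕ → ℕ
rthBest r xs with nth (r ∸ 1) (sort xs)
... | just s = s
... | nothing = 0

-- The first t-1 items are rejected,
-- s_r is the r-th best of them, then the first k items better than s_r
-- (i.e. of smaller rank) are accepted.
singleRef : ℕ → ℕ → ℕ → List ℕ → List ℕ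
singleRef k t r σ =
  take k (filter (λ x → x <? rthBest r (take (t ∸ 1) σ)) (drop (t ∸ 1) σ))

acceptsAs : ℕ → ℕ → ℕ → ℕ → ℕ → List ℕ → Bool
acceptsAs k t r d j σ with nth j (singleRef k t r σ)
... | just x = Relation.Nullary.Decidable.does (x ≟ d)
... | nothing = false

count : (List ℕ → Bool) → List (List ℕ) → ℕ
count P [] = 0
count P (x ∷ xs) = if P x then suc (count P xs) else count P xs

prob : ℕ → ℕ → ℕ → ℕ → ℕ → ℕ → ℚ
prob n k t r d j = count (acceptsAs k t r d j) (arrivalOrders n) ÷ℕ (n !)

-- Write t = s + 1 and let F n s q be the number of arrival orders of the
-- items 1, …, n in which v_d sits at position q (0-based) and is accepted as the
-- (j+1)-th item.  Inserting the worst item n + 1 at each of the n + 1 positions of an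
-- order of 1, …, n produces every order of 1, …, n + 1 exactly once, and the worst
-- item never changes the reference s_r (while the sample holds at least r other
-- items) nor gets accepted.  Hence F satisfies the recursion
--   F (n+1) (s+1) (q+1) = (s+1) F n s q + (q-s) F n (s+1) q + (n-q-1) F n (s+1) (q+1),
-- with a different first term when s + 1 = r, where the worst item becomes the
-- reference itself and every later item is accepted.  The closed form
--   G = κ s^(r) C(q-s, j) (q-r-j)! (n-1)^(n-1-q)
-- satisfies the same recursion, so F = G by induction on n; summing over the position
-- i = q + 1 of v_d and dividing by n! gives the formula.
module Submission where

open import Defs
open import Data.Bool.Base using (Bool; true; false; T; _∧_)
open import Data.Bool.Properties using (∧-zeroʳ; ∧-idem)
open import Data.Empty using (⊥-elim)
open import Data.List.Base
  using (List; []; _∷_; _++_; [_]; map; concatMap; length; take; drop; filter; upTo)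
import Data.List.Properties as List
open import Data.List.Membership.Propositional using (_∈_; _∉_)
open import Data.List.Membership.Propositional.Properties using (∈-filter⁻)
open import Data.List.Relation.Binary.Permutation.Propositional as ↭
  using (_↭_; ↭-sym; ↭-trans; ↭-reflexive; prep; swap)
open import Data.List.Relation.Binary.Permutation.Propositional.Properties
  using (++⁺ˡ; ++⁺ʳ; ++⁺; shifts; ++-comm; map⁺; ↭-length; All-resp-↭)
import Data.List.Relation.Binary.Permutation.Setoid.Properties as Setoid↭
open import Data.List.Relation.Unary.All as All using (All; []; _∷_)
import Data.List.Relation.Unary.All.Properties as All
open import Data.List.Relation.Unary.Any using (here; there)
open import Data.List.Relation.Unary.AllPairs using (_∷_)
open import Data.List.Relation.Unary.Unique.Propositional using (Unique)
import Data.List.Relation.Unary.Unique.Propositional.Properties as Unique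
open import Data.Maybe.Base using (Maybe; just; nothing; fromMaybe)
open import Data.Nat.Base
open import Data.Nat.Combinatorics using (_C_; k>n⇒nCk≡0; nCn≡1; nCk+nC[k+1]≡[n+1]C[k+1])
open import Data.Nat.Properties
open import Data.Nat.Tactic.RingSolver using (solve-∀)
open import Data.Integer.Base as ℤ using () renaming (+_ to pos)
import Data.Integer.Properties as ℤ
open import Data.Rational.Base using (ℚ; 0ℚ; toℚᵘ) renaming (_+_ to _+ℚ_; _*_ to _*ℚ_)
import Data.Rational.Properties as ℚ
open import Data.Rational.Unnormalised.Base as ℚᵘ using (mkℚᵘ; _≃_; *≡*)
import Data.Rational.Unnormalised.Properties as ℚᵘ
open import Data.Product using (_×_; _,_; proj₁; proj₂)
open import Data.Unit using (tt)
open import Function.Base using (_∘_)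
open import Relation.Binary.PropositionalEquality hiding ([_])
open import Relation.Nullary using (¬_; yes; no; does)

-- Permutations of the items

count-++ : ∀ (P : List ℕ → Bool) xs ys → count P (xs ++ ys) ≡ count P xs + count P ys
count-++ P [] ys = refl
count-++ P (x ∷ xs) ys with P x
... | true = cong suc (count-++ P xs ys)
... | false = count-++ P xs ys

count-↭ : ∀ (P : List ℕ → Bool) {xs ys} → xs ↭ ys → count P xs ≡ count P ys
count-↭ P ↭.refl = refl
count-↭ P (prep x p) with P x
... | true = cong suc (count-↭ P p)
... | false = count-↭ P p
count-↭ P (swap x y p) with P x | P y
... | true | true = cong (2 +_) (count-↭ P p)
... | true | false = cong suc (count-↭ P p)
... | false | true = cong suc (count-↭ P p)
... | false | false = count-↭ P p
count-↭ P (↭.trans p q) = trans (count-↭ P p) (count-↭ P q)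

concatMap-↭ : ∀ {A B : Set} (f : A → List B) {xs ys} → xs ↭ ys → concatMap f xs ↭ concatMap f ys
concatMap-↭ f ↭.refl = ↭.refl
concatMap-↭ f (prep x p) = ++⁺ˡ (f x) (concatMap-↭ f p)
concatMap-↭ f (swap x y p) = ↭-trans (shifts (f x) (f y)) (++⁺ˡ (f y) (++⁺ˡ (f x) (concatMap-↭ f p)))
concatMap-↭ f (↭.trans p q) = ↭-trans (concatMap-↭ f p) (concatMap-↭ f q)

concatMap-↭-pointwise : ∀ {A B : Set} {f g : A → List B} → (∀ x → f x ↭ g x) →
  ∀ xs → concatMap f xs ↭ concatMap g xs
concatMap-↭-pointwise f↭g [] = ↭.refl
concatMap-↭-pointwise f↭g (x ∷ xs) = ++⁺ (f↭g x) (concatMap-↭-pointwise f↭g xs)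

concatMap-concatMap : ∀ {A B C : Set} (f : B → List C) (g : A → List B) xs →
  concatMap f (concatMap g xs) ≡ concatMap (λ x → concatMap f (g x)) xs
concatMap-concatMap f g [] = refl
concatMap-concatMap f g (x ∷ xs) =
  trans (List.concatMap-++ f (g x) (concatMap g xs)) (cong (concatMap f (g x) ++_) (concatMap-concatMap f g xs))

concatMap-insertAll-map-∷ : ∀ x z (ws : List (List ℕ)) →
  concatMap (insertAll x) (map (z ∷_) ws) ↭ map (λ w → x ∷ z ∷ w) ws ++ map (z ∷_) (concatMap (insertAll x) ws)
concatMap-insertAll-map-∷ x z [] = ↭.refl
concatMap-insertAll-map-∷ x z (w ∷ ws) = prep _
  (↭-trans (++⁺ˡ (map (z ∷_) (insertAll x w)) (concatMap-insertAll-map-∷ x z ws))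
  (↭-trans (shifts (map (z ∷_) (insertAll x w)) (map (λ w → x ∷ z ∷ w) ws))
           (++⁺ˡ (map (λ w → x ∷ z ∷ w) ws) (↭-reflexive (sym (List.map-++ (z ∷_) (insertAll x w) _))))))

insertBoth : ℕ → ℕ → List ℕ → List (List ℕ)
insertBoth x y σ = concatMap (insertAll x) (insertAll y σ)

-- The orders of insertBoth x y (z ∷ zs), grouped by which of x, y, z comes first.
insertBoth-∷-shape : ℕ → ℕ → ℕ → List ℕ → List (List ℕ) → List (List ℕ)
insertBoth-∷-shape x y z zs rest = (x ∷ y ∷ z ∷ zs) ∷ (y ∷ x ∷ z ∷ zs) ∷
  (map (λ w → y ∷ z ∷ w) (insertAll x zs) ++ map (λ w → x ∷ z ∷ w) (insertAll y zs) ++ map (z ∷_) rest)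

insertBoth-∷ : ∀ x y z zs → insertBoth x y (z ∷ zs) ↭ insertBoth-∷-shape x y z zs (insertBoth x y zs)
insertBoth-∷ x y z zs = prep _ (prep _
  (↭-trans (++⁺ʳ (concatMap (insertAll x) (map (z ∷_) (insertAll y zs)))
                 (↭-reflexive (sym (List.map-∘ (insertAll x zs)))))
           (++⁺ˡ (map (λ w → y ∷ z ∷ w) (insertAll x zs)) (concatMap-insertAll-map-∷ x z (insertAll y zs)))))

insertBoth-∷-shape-swap : ∀ x y z zs {R S} → R ↭ S → insertBoth-∷-shape x y z zs R ↭ insertBoth-∷-shape y x z zs S
insertBoth-∷-shape-swap x y z zs R↭S = swap _ _ (↭-trans
  (shifts (map (λ w → y ∷ z ∷ w) (insertAll x zs)) (map (λ w → x ∷ z ∷ w) (insertAll y zs)))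
  (++⁺ˡ (map (λ w → x ∷ z ∷ w) (insertAll y zs)) (++⁺ˡ (map (λ w → y ∷ z ∷ w) (insertAll x zs)) (map⁺ (z ∷_) R↭S))))

insertBoth-comm : ∀ x y σ → insertBoth x y σ ↭ insertBoth y x σ
insertBoth-comm x y [] = swap _ _ ↭.refl
insertBoth-comm x y (z ∷ zs) = ↭-trans (insertBoth-∷ x y z zs)
  (↭-trans (insertBoth-∷-shape-swap x y z zs (insertBoth-comm x y zs)) (↭-sym (insertBoth-∷ y x z zs)))

perms-swap : ∀ x y xs → perms (x ∷ y ∷ xs) ↭ perms (y ∷ x ∷ xs)
perms-swap x y xs = ↭-trans (↭-reflexive (concatMap-concatMap (insertAll x) (insertAll y) (perms xs)))
  (↭-trans (concatMap-↭-pointwise (insertBoth-comm x y) (perms xs))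
           (↭-reflexive (sym (concatMap-concatMap (insertAll y) (insertAll x) (perms xs)))))

perms-↭ : ∀ {xs ys} → xs ↭ ys → perms xs ↭ perms ys
perms-↭ ↭.refl = ↭.refl
perms-↭ (prep x p) = concatMap-↭ (insertAll x) (perms-↭ p)
perms-↭ (swap {xs} x y p) = ↭-trans (perms-swap x y xs) (concatMap-↭ (insertAll y) (concatMap-↭ (insertAll x) (perms-↭ p)))
perms-↭ (↭.trans p q) = ↭-trans (perms-↭ p) (perms-↭ q)

count-arrivalOrders-suc : ∀ (P : List ℕ → Bool) n →
  count P (arrivalOrders (suc n)) ≡ count P (concatMap (insertAll (suc n)) (arrivalOrders n))
count-arrivalOrders-suc P n = count-↭ P (perms-↭ (↭-trans (↭-reflexive lastSplit) (++-comm (map suc (upTo n)) [ suc n ])))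
  where
  lastSplit : map suc (upTo (suc n)) ≡ map suc (upTo n) ++ [ suc n ]
  lastSplit = trans (cong (map suc) (sym (List.upTo-∷ʳ n))) (List.map-++ suc (upTo n) [ n ])

All-insertAll-↭ : ∀ x σ → All (_↭ x ∷ σ) (insertAll x σ)
All-insertAll-↭ x [] = ↭.refl ∷ []
All-insertAll-↭ x (y ∷ ys) = ↭.refl ∷ All.map⁺ (All.map (λ p → ↭-trans (prep y p) (swap y x ↭.refl)) (All-insertAll-↭ x ys))

All-perms-↭ : ∀ xs → All (_↭ xs) (perms xs)
All-perms-↭ [] = ↭.refl ∷ []
All-perms-↭ (x ∷ xs) = All.concat⁺ (All.map⁺
  (All.map (λ σ↭xs → All.map (λ w↭ → ↭-trans w↭ (prep x σ↭xs)) (All-insertAll-↭ x _)) (All-perms-↭ xs)))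

IsArrangement : ℕ → List ℕ → Set
IsArrangement n σ = Unique σ × All (_≤ n) σ × length σ ≡ n

arrivalOrders-arrangement : ∀ n → All (IsArrangement n) (arrivalOrders n)
arrivalOrders-arrangement n = All.map arrangement (All-perms-↭ (map suc (upTo n)))
  where
  arrangement : ∀ {σ} → σ ↭ map suc (upTo n) → IsArrangement n σ
  arrangement σ↭ =
      Setoid↭.Unique-resp-↭ (setoid ℕ) (↭.↭⇒↭ₛ (↭-sym σ↭)) (Unique.map⁺ suc-injective (Unique.upTo⁺ n))
    , All-resp-↭ (↭-sym σ↭) (All.map⁺ (All.applyUpTo⁺₁ (λ i → i) n (λ i<n → i<n)))
    , trans (↭-length σ↭) (trans (List.length-map suc (upTo n)) (List.length-upTo n))

-- Finite sums

*-cong-pos : ∀ c {v w} → (0 < c → v ≡ w) → c * v ≡ c * w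
*-cong-pos zero _ = refl
*-cong-pos (suc c) v≡w = cong (suc c *_) (v≡w z<s)

0<∸⇒> : ∀ {m n} → 0 < m ∸ n → n < m
0<∸⇒> = m∸n≢0⇒n<m ∘ n>0⇒n≢0

⟦_⟧ : Bool → ℕ
⟦ true ⟧ = 1
⟦ false ⟧ = 0

sumBelow : (ℕ → ℕ) → ℕ → ℕ
sumBelow f zero = 0
sumBelow f (suc n) = f 0 + sumBelow (λ p → f (suc p)) n

sumBelow-+ : ∀ f a b → sumBelow f (a + b) ≡ sumBelow f a + sumBelow (λ u → f (a + u)) b
sumBelow-+ f zero b = refl
sumBelow-+ f (suc a) b = trans (cong (f 0 +_) (sumBelow-+ (λ p → f (suc p)) a b)) (sym (+-assoc (f 0) _ _))

sumBelow-suc : ∀ f n → sumBelow f (suc n) ≡ sumBelow f n + f n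
sumBelow-suc f zero = +-identityʳ (f 0)
sumBelow-suc f (suc n) = trans (cong (f 0 +_) (sumBelow-suc (λ p → f (suc p)) n)) (sym (+-assoc (f 0) _ _))

sumBelow-cong : ∀ {f g} n → (∀ u → u < n → f u ≡ g u) → sumBelow f n ≡ sumBelow g n
sumBelow-cong zero f≡g = refl
sumBelow-cong (suc n) f≡g = cong₂ _+_ (f≡g 0 z<s) (sumBelow-cong n (λ u u<n → f≡g (suc u) (s<s u<n)))

sumBelow-const : ∀ {f} c n → (∀ u → u < n → f u ≡ c) → sumBelow f n ≡ n * c
sumBelow-const c zero f≡c = refl
sumBelow-const c (suc n) f≡c = cong₂ _+_ (f≡c 0 z<s) (sumBelow-const c n (λ u u<n → f≡c (suc u) (s<s u<n)))

sumBelow-blocks : ∀ {f} {s q L A X Z Y} → s ≤ q → q ≤ L →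
  (∀ p → p < s → f p ≡ A) → (∀ p → s ≤ p → p < q → f p ≡ X) → f q ≡ Z → (∀ p → q < p → p ≤ L → f p ≡ Y) →
  sumBelow f (suc L) ≡ s * A + (q ∸ s) * X + Z + (L ∸ q) * Y
sumBelow-blocks {f} {s} {q} {L} {A} {X} {Z} {Y} s≤q q≤L onA onX atq onY = begin
  sumBelow f (suc L)
    ≡⟨ cong (sumBelow f) L+1≡ ⟩
  sumBelow f (s + (q ∸ s + suc (L ∸ q)))
    ≡⟨ sumBelow-+ f s _ ⟩
  sumBelow f s + sumBelow (λ u → f (s + u)) (q ∸ s + suc (L ∸ q))
    ≡⟨ cong (sumBelow f s +_) (sumBelow-+ (λ u → f (s + u)) (q ∸ s) (suc (L ∸ q))) ⟩
  sumBelow f s + (sumBelow (λ u → f (s + u)) (q ∸ s) + (f (s + (q ∸ s + 0)) + sumBelow (λ u → f (s + (q ∸ s + suc u))) (L ∸ q)))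
    ≡⟨ cong₂ _+_ (sumBelow-const A s onA) (cong₂ _+_ sumX (cong₂ _+_ (trans (cong f s+[q-s+0]≡q) atq) sumY)) ⟩
  s * A + ((q ∸ s) * X + (Z + (L ∸ q) * Y))
    ≡⟨ reassoc (s * A) ((q ∸ s) * X) Z ((L ∸ q) * Y) ⟩
  s * A + (q ∸ s) * X + Z + (L ∸ q) * Y ∎
  where
  open ≡-Reasoning
  reassoc : ∀ a b c d → a + (b + (c + d)) ≡ a + b + c + d
  reassoc = solve-∀
  s+[q-s]≡q : s + (q ∸ s) ≡ q
  s+[q-s]≡q = m+[n∸m]≡n s≤q
  s+[q-s+0]≡q : s + (q ∸ s + 0) ≡ q
  s+[q-s+0]≡q = trans (cong (s +_) (+-identityʳ (q ∸ s))) s+[q-s]≡q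
  shift : ∀ u → s + (q ∸ s + u) ≡ q + u
  shift u = trans (sym (+-assoc s (q ∸ s) u)) (cong (_+ u) s+[q-s]≡q)
  L+1≡ : suc L ≡ s + (q ∸ s + suc (L ∸ q))
  L+1≡ = sym (trans (shift (suc (L ∸ q))) (trans (+-suc q (L ∸ q)) (cong suc (m+[n∸m]≡n q≤L))))
  sumX : sumBelow (λ u → f (s + u)) (q ∸ s) ≡ (q ∸ s) * X
  sumX = sumBelow-const X (q ∸ s) (λ u u<q-s → onX (s + u) (m≤m+n s u) (subst (s + u <_) s+[q-s]≡q (+-monoʳ-< s u<q-s)))
  sumY : sumBelow (λ u → f (s + (q ∸ s + suc u))) (L ∸ q) ≡ (L ∸ q) * Y
  sumY = sumBelow-const Y (L ∸ q) (λ u u<L-q → subst (λ p → f p ≡ Y) (sym (shift (suc u)))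
    (onY (q + suc u) (m<m+n q z<s) (subst (q + suc u ≤_) (m+[n∸m]≡n q≤L) (+-monoʳ-≤ q u<L-q))))

sumOver : (List ℕ → ℕ) → List (List ℕ) → ℕ
sumOver g [] = 0
sumOver g (σ ∷ Π) = g σ + sumOver g Π

count≡sumOver : ∀ (P : List ℕ → Bool) Π → count P Π ≡ sumOver (λ σ → ⟦ P σ ⟧) Π
count≡sumOver P [] = refl
count≡sumOver P (σ ∷ Π) with P σ
... | true = cong suc (count≡sumOver P Π)
... | false = count≡sumOver P Π

count-concatMap : ∀ (P : List ℕ → Bool) f Π → count P (concatMap f Π) ≡ sumOver (λ σ → count P (f σ)) Π
count-concatMap P f [] = refl
count-concatMap P f (σ ∷ Π) = trans (count-++ P (f σ) (concatMap f Π)) (cong (count P (f σ) +_) (count-concatMap P f Π))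

sumOver-cong : ∀ {Q : List ℕ → Set} {g h} Π → All Q Π → (∀ {σ} → Q σ → g σ ≡ h σ) → sumOver g Π ≡ sumOver h Π
sumOver-cong [] [] g≡h = refl
sumOver-cong (σ ∷ Π) (q ∷ qs) g≡h = cong₂ _+_ (g≡h q) (sumOver-cong Π qs g≡h)

sumOver-+ : ∀ g h Π → sumOver (λ σ → g σ + h σ) Π ≡ sumOver g Π + sumOver h Π
sumOver-+ g h [] = refl
sumOver-+ g h (σ ∷ Π) = trans (cong (g σ + h σ +_) (sumOver-+ g h Π)) (interchange (g σ) (h σ) (sumOver g Π) (sumOver h Π))
  where
  interchange : ∀ a b c d → a + b + (c + d) ≡ a + c + (b + d)
  interchange = solve-∀

sumOver-* : ∀ c g Π → sumOver (λ σ → c * g σ) Π ≡ c * sumOver g Π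
sumOver-* c g [] = sym (*-zeroʳ c)
sumOver-* c g (σ ∷ Π) = trans (cong (c * g σ +_) (sumOver-* c g Π)) (sym (*-distribˡ-+ c (g σ) (sumOver g Π)))

sumOver-sumBelow : ∀ (g : ℕ → List ℕ → ℕ) n Π →
  sumOver (λ σ → sumBelow (λ q → g q σ) n) Π ≡ sumBelow (λ q → sumOver (g q) Π) n
sumOver-sumBelow g zero Π = sumOver-* 0 (λ _ → 0) Π
sumOver-sumBelow g (suc n) Π = trans (sumOver-+ (g 0) (λ σ → sumBelow (λ q → g (suc q) σ) n) Π)
  (cong (sumOver (g 0) Π +_) (sumOver-sumBelow (λ q → g (suc q)) n Π))

count-false : ∀ Π → count (λ _ → false) Π ≡ 0
count-false [] = refl
count-false (_ ∷ Π) = count-false Π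

count-cong : ∀ {Q : List ℕ → Set} {P P' : List ℕ → Bool} Π → All Q Π → (∀ {σ} → Q σ → P σ ≡ P' σ) →
  count P Π ≡ count P' Π
count-cong {P = P} {P'} Π qs P≡P' =
  trans (count≡sumOver P Π) (trans (sumOver-cong Π qs (λ q → cong ⟦_⟧ (P≡P' q))) (sym (count≡sumOver P' Π)))

-- Inserting the worst item

insAt : ℕ → ℕ → List ℕ → List ℕ
insAt zero x σ = x ∷ σ
insAt (suc p) x [] = x ∷ []
insAt (suc p) x (y ∷ ys) = y ∷ insAt p x ys

count-∷ : ∀ (P : List ℕ → Bool) σ Π → count P (σ ∷ Π) ≡ ⟦ P σ ⟧ + count P Π
count-∷ P σ Π with P σ
... | true = refl
... | false = refl

count-map : ∀ (P : List ℕ → Bool) (g : List ℕ → List ℕ) Π → count P (map g Π) ≡ count (λ σ → P (g σ)) Π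
count-map P g [] = refl
count-map P g (σ ∷ Π) with P (g σ)
... | true = cong suc (count-map P g Π)
... | false = count-map P g Π

count-insertAll : ∀ (P : List ℕ → Bool) x σ →
  count P (insertAll x σ) ≡ sumBelow (λ p → ⟦ P (insAt p x σ) ⟧) (suc (length σ))
count-insertAll P x [] = count-∷ P (x ∷ []) []
count-insertAll P x (y ∷ ys) = trans (count-∷ P (x ∷ y ∷ ys) (map (y ∷_) (insertAll x ys)))
  (cong (⟦ P (x ∷ y ∷ ys) ⟧ +_) (trans (count-map P (y ∷_) (insertAll x ys)) (count-insertAll (λ σ → P (y ∷ σ)) x ys)))

count-arrivalOrders-by-insertion : ∀ (P : List ℕ → Bool) n (g : List ℕ → ℕ) →
  (∀ {σ} → IsArrangement n σ → sumBelow (λ p → ⟦ P (insAt p (suc n) σ) ⟧) (suc n) ≡ g σ) →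
  count P (arrivalOrders (suc n)) ≡ sumOver g (arrivalOrders n)
count-arrivalOrders-by-insertion P n g perOrder =
  trans (count-arrivalOrders-suc P n) (trans (count-concatMap P (insertAll (suc n)) (arrivalOrders n))
    (sumOver-cong (arrivalOrders n) (arrivalOrders-arrangement n)
      (λ {σ} arr → trans (count-insertAll P (suc n) σ)
         (trans (cong (λ m → sumBelow (λ p → ⟦ P (insAt p (suc n) σ) ⟧) (suc m)) (proj₂ (proj₂ arr))) (perOrder arr)))))

take-suc-insAt : ∀ {p a} x σ → p ≤ a → take (suc a) (insAt p x σ) ≡ insAt p x (take a σ)
take-suc-insAt {zero} x σ _ = refl
take-suc-insAt {suc p} {a} x [] _ = trans (cong (x ∷_) (List.take-[] a)) (cong (insAt (suc p) x) (sym (List.take-[] a)))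
take-suc-insAt {suc p} {suc a} x (y ∷ ys) (s≤s p≤a) = cong (y ∷_) (take-suc-insAt x ys p≤a)

drop-suc-insAt : ∀ {p a} x σ → p ≤ a → drop (suc a) (insAt p x σ) ≡ drop a σ
drop-suc-insAt {zero} x σ _ = refl
drop-suc-insAt {suc p} x [] _ = refl
drop-suc-insAt {suc p} {suc a} x (y ∷ ys) (s≤s p≤a) = drop-suc-insAt x ys p≤a

take-insAt : ∀ {a p} x σ → a ≤ p → p ≤ length σ → take a (insAt p x σ) ≡ take a σ
take-insAt {zero} x σ _ _ = refl
take-insAt {suc a} {suc p} x (y ∷ ys) (s≤s a≤p) (s≤s p≤len) = cong (y ∷_) (take-insAt x ys a≤p p≤len)

drop-insAt : ∀ {a p} x σ → a ≤ p → p ≤ length σ → drop a (insAt p x σ) ≡ insAt (p ∸ a) x (drop a σ)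
drop-insAt {zero} x σ _ _ = refl
drop-insAt {suc a} {suc p} x (y ∷ ys) (s≤s a≤p) (s≤s p≤len) = drop-insAt x ys a≤p p≤len

nth-insAt-before : ∀ {p a} x σ → p ≤ a → nth (suc a) (insAt p x σ) ≡ nth a σ
nth-insAt-before {zero} x σ _ = refl
nth-insAt-before {suc p} {zero} x [] _ = refl
nth-insAt-before {suc p} {suc a} x [] _ = refl
nth-insAt-before {suc p} {suc a} x (y ∷ ys) (s≤s p≤a) = nth-insAt-before x ys p≤a

nth-insAt-before′ : ∀ {a p} x σ → p < a → nth a (insAt p x σ) ≡ nth (a ∸ 1) σ
nth-insAt-before′ {suc a} x σ (s≤s p≤a) = nth-insAt-before x σ p≤a

nth-insAt-here : ∀ {p} x σ → p ≤ length σ → nth p (insAt p x σ) ≡ just x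
nth-insAt-here {zero} x σ _ = refl
nth-insAt-here {suc p} x (y ∷ ys) (s≤s p≤len) = nth-insAt-here x ys p≤len

nth-insAt-after : ∀ {a p} x σ → a < p → p ≤ length σ → nth a (insAt p x σ) ≡ nth a σ
nth-insAt-after {zero} {suc p} x (y ∷ ys) _ _ = refl
nth-insAt-after {suc a} {suc p} x (y ∷ ys) (s≤s a<p) (s≤s p≤len) = nth-insAt-after x ys a<p p≤len

nth-take : ∀ {j k} (xs : List ℕ) → j < k → nth j (take k xs) ≡ nth j xs
nth-take {j} {suc k} [] _ = refl
nth-take {zero} {suc k} (y ∷ ys) _ = refl
nth-take {suc j} {suc k} (y ∷ ys) (s≤s j<k) = nth-take ys j<k

nth-drop : ∀ a j (xs : List ℕ) → nth j (drop a xs) ≡ nth (a + j) xs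
nth-drop zero j xs = refl
nth-drop (suc a) zero [] = refl
nth-drop (suc a) (suc j) [] = refl
nth-drop (suc a) j (y ∷ ys) = nth-drop a j ys

nth-++ˡ : ∀ {i} (xs ys : List ℕ) → i < length xs → nth i (xs ++ ys) ≡ nth i xs
nth-++ˡ {zero} (x ∷ xs) ys _ = refl
nth-++ˡ {suc i} (x ∷ xs) ys (s≤s i<len) = nth-++ˡ xs ys i<len

nth-length-∷ʳ : ∀ (xs : List ℕ) x → nth (length xs) (xs ++ [ x ]) ≡ just x
nth-length-∷ʳ [] x = refl
nth-length-∷ʳ (y ∷ xs) x = nth-length-∷ʳ xs x

nth⇒∈ : ∀ i (xs : List ℕ) {y} → nth i xs ≡ just y → y ∈ xs
nth⇒∈ zero (x ∷ xs) refl = here refl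
nth⇒∈ (suc i) (x ∷ xs) eq = there (nth⇒∈ i xs eq)

nth-All : ∀ {Q : ℕ → Set} i {xs : List ℕ} {y} → All Q xs → nth i xs ≡ just y → Q y
nth-All zero (q ∷ _) refl = q
nth-All (suc i) (_ ∷ qs) eq = nth-All i qs eq

∈-take⁻ : ∀ k (xs : List ℕ) {y} → y ∈ take k xs → y ∈ xs
∈-take⁻ (suc k) (x ∷ xs) (here eq) = here eq
∈-take⁻ (suc k) (x ∷ xs) (there y∈) = there (∈-take⁻ k xs y∈)

∈-drop⁻ : ∀ k (xs : List ℕ) {y} → y ∈ drop k xs → y ∈ xs
∈-drop⁻ zero xs y∈ = y∈
∈-drop⁻ (suc k) (x ∷ xs) y∈ = there (∈-drop⁻ k xs y∈)

-- The reference item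

All-ins : ∀ {Q : ℕ → Set} {x} xs → Q x → All Q xs → All Q (ins x xs)
All-ins [] qx [] = qx ∷ []
All-ins {x = x} (y ∷ ys) qx (qy ∷ qs) with y <ᵇ x
... | true = qy ∷ All-ins ys qx qs
... | false = qx ∷ qy ∷ qs

All-sort : ∀ {Q : ℕ → Set} xs → All Q xs → All Q (sort xs)
All-sort [] [] = []
All-sort (x ∷ xs) (qx ∷ qs) = All-ins (sort xs) qx (All-sort xs qs)

length-ins : ∀ x xs → length (ins x xs) ≡ suc (length xs)
length-ins x [] = refl
length-ins x (y ∷ ys) with y <ᵇ x
... | true = cong suc (length-ins x ys)
... | false = refl

length-sort : ∀ xs → length (sort xs) ≡ length xs
length-sort [] = refl
length-sort (x ∷ xs) = trans (length-ins x (sort xs)) (cong suc (length-sort xs))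

<⇒<ᵇ≡true : ∀ {a b} → a < b → (a <ᵇ b) ≡ true
<⇒<ᵇ≡true {a} {b} a<b with a <ᵇ b in eq
... | true = refl
... | false = ⊥-elim (subst T eq (<⇒<ᵇ a<b))

<⇒>ᵇ≡false : ∀ {a b} → a < b → (b <ᵇ a) ≡ false
<⇒>ᵇ≡false {a} {b} a<b with b <ᵇ a in eq
... | false = refl
... | true = ⊥-elim (<-asym a<b (<ᵇ⇒< b a (subst T (sym eq) tt)))

ins-max : ∀ x xs → All (_< x) xs → ins x xs ≡ xs ++ [ x ]
ins-max x [] [] = refl
ins-max x (y ∷ ys) (y<x ∷ ys<x) rewrite <⇒<ᵇ≡true y<x = cong (y ∷_) (ins-max x ys ys<x)

ins-++-max : ∀ a x xs → a < x → ins a (xs ++ [ x ]) ≡ ins a xs ++ [ x ]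
ins-++-max a x [] a<x rewrite <⇒>ᵇ≡false a<x = refl
ins-++-max a x (y ∷ ys) a<x with y <ᵇ a
... | true = cong (y ∷_) (ins-++-max a x ys a<x)
... | false = refl

sort-insAt-max : ∀ p x xs → All (_< x) xs → sort (insAt p x xs) ≡ sort xs ++ [ x ]
sort-insAt-max zero x xs xs<x = ins-max x (sort xs) (All-sort xs xs<x)
sort-insAt-max (suc p) x [] [] = refl
sort-insAt-max (suc p) x (y ∷ ys) (y<x ∷ ys<x) = trans (cong (ins y) (sort-insAt-max p x ys ys<x)) (ins-++-max y x (sort ys) y<x)

rthBest≡ : ∀ r xs → rthBest r xs ≡ fromMaybe 0 (nth (r ∸ 1) (sort xs))
rthBest≡ r xs with nth (r ∸ 1) (sort xs)
... | just s = refl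
... | nothing = refl

rthBest-insAt-max : ∀ {r} p x xs → 1 ≤ r → r ≤ length xs → All (_< x) xs → rthBest r (insAt p x xs) ≡ rthBest r xs
rthBest-insAt-max {suc r} p x xs _ r<len xs<x = begin
  rthBest (suc r) (insAt p x xs)          ≡⟨ rthBest≡ (suc r) (insAt p x xs) ⟩
  fromMaybe 0 (nth r (sort (insAt p x xs))) ≡⟨ cong (λ ys → fromMaybe 0 (nth r ys)) (sort-insAt-max p x xs xs<x) ⟩
  fromMaybe 0 (nth r (sort xs ++ [ x ]))   ≡⟨ cong (fromMaybe 0) (nth-++ˡ (sort xs) [ x ] (subst (r <_) (sym (length-sort xs)) r<len)) ⟩
  fromMaybe 0 (nth r (sort xs))            ≡⟨ rthBest≡ (suc r) xs ⟨
  rthBest (suc r) xs                       ∎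
  where open ≡-Reasoning

rthBest-insAt-max-last : ∀ {r} p x xs → suc (length xs) ≡ r → All (_< x) xs → rthBest r (insAt p x xs) ≡ x
rthBest-insAt-max-last {suc r} p x xs refl xs<x = begin
  rthBest (suc r) (insAt p x xs)                         ≡⟨ rthBest≡ (suc r) (insAt p x xs) ⟩
  fromMaybe 0 (nth r (sort (insAt p x xs)))                ≡⟨ cong (λ ys → fromMaybe 0 (nth r ys)) (sort-insAt-max p x xs xs<x) ⟩
  fromMaybe 0 (nth (length xs) (sort xs ++ [ x ]))        ≡⟨ cong (λ i → fromMaybe 0 (nth i (sort xs ++ [ x ]))) (length-sort xs) ⟨
  fromMaybe 0 (nth (length (sort xs)) (sort xs ++ [ x ])) ≡⟨ cong (fromMaybe 0) (nth-length-∷ʳ (sort xs) x) ⟩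
  x                                                        ∎
  where open ≡-Reasoning

rthBest-< : ∀ r x xs → 0 < x → All (_< x) xs → rthBest r xs < x
rthBest-< r x xs 0<x xs<x = subst (_< x) (sym (rthBest≡ r xs)) (bounded (nth (r ∸ 1) (sort xs)) refl)
  where
  bounded : ∀ m → nth (r ∸ 1) (sort xs) ≡ m → fromMaybe 0 m < x
  bounded (just s) eq = nth-All (r ∸ 1) (All-sort xs xs<x) eq
  bounded nothing _ = 0<x

is : ℕ → Maybe ℕ → Bool
is d (just x) = does (x ≟ d)
is d nothing = false

acceptsAs≡ : ∀ k t r d j σ → acceptsAs k t r d j σ ≡ is d (nth j (singleRef k t r σ))
acceptsAs≡ k t r d j σ with nth j (singleRef k t r σ)
... | just x = refl
... | nothing = refl

acceptsAs-cong : ∀ k r d j t t' σ σ' → singleRef k t r σ ≡ singleRef k t' r σ' → acceptsAs k t r d j σ ≡ acceptsAs k t' r d j σ'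
acceptsAs-cong k r d j t t' σ σ' eq =
  trans (acceptsAs≡ k t r d j σ) (trans (cong (λ xs → is d (nth j xs)) eq) (sym (acceptsAs≡ k t' r d j σ')))

is-true : ∀ d m → is d m ≡ true → m ≡ just d
is-true d (just x) eq = cong just (≡ᵇ⇒≡ x d (subst T (sym eq) tt))

is-just : ∀ d → is d (just d) ≡ true
is-just d with d ≡ᵇ d in eq
... | true = refl
... | false = ⊥-elim (subst T eq (≡⇒≡ᵇ d d refl))

is-≢ : ∀ d y → y ≢ d → is d (just y) ≡ false
is-≢ d y y≢d with y ≡ᵇ d in eq
... | true = ⊥-elim (y≢d (≡ᵇ⇒≡ y d (subst T (sym eq) tt)))
... | false = refl

is-∉ : ∀ d i (σ : List ℕ) → d ∉ σ → is d (nth i σ) ≡ false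
is-∉ d i σ d∉σ with nth i σ in eq
... | nothing = refl
... | just y = is-≢ d y (λ y≡d → d∉σ (subst (_∈ σ) y≡d (nth⇒∈ i σ eq)))

singleRef-split : ∀ k s r σ {ref post} → rthBest r (take s σ) ≡ ref → drop s σ ≡ post →
  singleRef k (suc s) r σ ≡ take k (filter (_<? ref) post)
singleRef-split k s r σ refl refl = refl

length-take-≤ : ∀ {a} (σ : List ℕ) → a ≤ length σ → length (take a σ) ≡ a
length-take-≤ {a} σ a≤len = trans (List.length-take a σ) (m≤n⇒m⊓n≡m a≤len)

singleRef-insAt-sample : ∀ k r {s p x σ} → 1 ≤ r → r ≤ s → p ≤ s → s ≤ length σ → All (_< x) σ →
  singleRef k (2 + s) r (insAt p x σ) ≡ singleRef k (suc s) r σ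
singleRef-insAt-sample k r {s} {p} {x} {σ} 1≤r r≤s p≤s s≤len σ<x = singleRef-split k (suc s) r (insAt p x σ)
  (trans (cong (rthBest r) (take-suc-insAt x σ p≤s))
         (rthBest-insAt-max p x (take s σ) 1≤r (subst (r ≤_) (sym (length-take-≤ σ s≤len)) r≤s) (All.take⁺ s σ<x)))
  (drop-suc-insAt x σ p≤s)

singleRef-insAt-late : ∀ k r {s p x σ} → s ≤ p → p ≤ length σ → 0 < x → All (_< x) σ →
  singleRef k (suc s) r (insAt p x σ) ≡ singleRef k (suc s) r σ
singleRef-insAt-late k r {s} {p} {x} {σ} s≤p p≤len 0<x σ<x = trans
  (singleRef-split k s r (insAt p x σ) (cong (rthBest r) (take-insAt x σ s≤p p≤len)) (drop-insAt x σ s≤p p≤len))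
  (cong (take k) (filter-insAt-rejected (p ∸ s) (drop s σ)))
  where
  ref = rthBest r (take s σ)
  x≮ref : ¬ x < ref
  x≮ref = <⇒≱ (rthBest-< r x (take s σ) 0<x (All.take⁺ s σ<x)) ∘ <⇒≤
  filter-insAt-rejected : ∀ i ys → filter (_<? ref) (insAt i x ys) ≡ filter (_<? ref) ys
  filter-insAt-rejected zero ys = List.filter-reject (_<? ref) x≮ref
  filter-insAt-rejected (suc i) [] = List.filter-reject (_<? ref) x≮ref
  filter-insAt-rejected (suc i) (y ∷ ys) with does (y <? ref)
  ... | true = cong (y ∷_) (filter-insAt-rejected i ys)
  ... | false = filter-insAt-rejected i ys

-- Inserted among the first r + 1 items, x is the (r+1)-th best of the sample, i.e. the
-- reference itself, so every later item is accepted.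
singleRef-insAt-reference : ∀ k {r p x σ} → p ≤ r → r ≤ length σ → All (_< x) σ →
  singleRef k (2 + r) (suc r) (insAt p x σ) ≡ take k (drop r σ)
singleRef-insAt-reference k {r} {p} {x} {σ} p≤r r≤len σ<x = trans
  (singleRef-split k (suc r) (suc r) (insAt p x σ)
    (trans (cong (rthBest (suc r)) (take-suc-insAt x σ p≤r))
           (rthBest-insAt-max-last p x (take r σ) (cong suc (length-take-≤ σ r≤len)) (All.take⁺ r σ<x)))
    (drop-suc-insAt x σ p≤r))
  (cong (take k) (List.filter-all (_<? x) (All.drop⁺ r σ<x)))

acceptsAs⇒∈-drop : ∀ k s r d j σ → acceptsAs k (suc s) r d j σ ≡ true → d ∈ drop s σ
acceptsAs⇒∈-drop k s r d j σ accepted = proj₁ (∈-filter⁻ (_<? rthBest r (take s σ))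
  (∈-take⁻ k _ (nth⇒∈ j _ (is-true d _ (trans (sym (acceptsAs≡ k (suc s) r d j σ)) accepted)))))

nth-unique : ∀ {a b d} (σ : List ℕ) → Unique σ → nth a σ ≡ just d → nth b σ ≡ just d → a ≡ b
nth-unique {zero} {zero} (y ∷ ys) _ _ _ = refl
nth-unique {zero} {suc b} (y ∷ ys) (y∉ys ∷ _) refl eq = ⊥-elim (All.lookup y∉ys (nth⇒∈ b ys eq) refl)
nth-unique {suc a} {zero} (y ∷ ys) (y∉ys ∷ _) eq refl = ⊥-elim (All.lookup y∉ys (nth⇒∈ a ys eq) refl)
nth-unique {suc a} {suc b} (y ∷ ys) (_ ∷ u) eqa eqb = cong suc (nth-unique ys u eqa eqb)

∈-drop⇒≤-position : ∀ {s q d} (σ : List ℕ) → Unique σ → d ∈ drop s σ → nth q σ ≡ just d → s ≤ q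
∈-drop⇒≤-position {zero} σ _ _ _ = z≤n
∈-drop⇒≤-position {suc s} {zero} (y ∷ ys) (y∉ys ∷ _) d∈ refl = ⊥-elim (All.lookup y∉ys (∈-drop⁻ s ys d∈) refl)
∈-drop⇒≤-position {suc s} {suc q} (y ∷ ys) (_ ∷ u) d∈ eq = s≤s (∈-drop⇒≤-position ys u d∈ eq)

occurrences-∉ : ∀ d (σ : List ℕ) → d ∉ σ → sumBelow (λ q → ⟦ is d (nth q σ) ⟧) (length σ) ≡ 0
occurrences-∉ d [] _ = refl
occurrences-∉ d (y ∷ ys) d∉ rewrite is-≢ d y (λ y≡d → d∉ (here (sym y≡d))) = occurrences-∉ d ys (d∉ ∘ there)

occurrences-∈ : ∀ d (σ : List ℕ) → Unique σ → d ∈ σ → sumBelow (λ q → ⟦ is d (nth q σ) ⟧) (length σ) ≡ 1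
occurrences-∈ d (y ∷ ys) (y∉ys ∷ _) (here refl) rewrite is-just y = cong suc (occurrences-∉ y ys (λ y∈ → All.lookup y∉ys y∈ refl))
occurrences-∈ d (y ∷ ys) (y∉ys ∷ u) (there d∈) rewrite is-≢ d y (All.lookup y∉ys d∈) = occurrences-∈ d ys u d∈

-- Counting arrival orders

sumOver-blocks : ∀ a b c (P Q R : List ℕ → Bool) Π →
  sumOver (λ σ → a * ⟦ P σ ⟧ + b * ⟦ Q σ ⟧ + 0 + c * ⟦ R σ ⟧) Π ≡ a * count P Π + b * count Q Π + 0 + c * count R Π
sumOver-blocks a b c P Q R Π =
  trans (sumOver-+ (λ σ → a * ⟦ P σ ⟧ + b * ⟦ Q σ ⟧ + 0) (λ σ → c * ⟦ R σ ⟧) Π)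
  (cong₂ _+_
    (trans (sumOver-+ (λ σ → a * ⟦ P σ ⟧ + b * ⟦ Q σ ⟧) (λ _ → 0) Π)
      (cong₂ _+_ (trans (sumOver-+ (λ σ → a * ⟦ P σ ⟧) (λ σ → b * ⟦ Q σ ⟧) Π) (cong₂ _+_ (scaled a P) (scaled b Q)))
                 (sumOver-* 0 (λ _ → 0) Π)))
    (scaled c R))
  where
  scaled : ∀ a P → sumOver (λ σ → a * ⟦ P σ ⟧) Π ≡ a * count P Π
  scaled a P = trans (sumOver-* a (λ σ → ⟦ P σ ⟧) Π) (cong (a *_) (sym (count≡sumOver P Π)))

count-arrivalOrders : ∀ n → count (λ _ → true) (arrivalOrders n) ≡ n !
count-arrivalOrders zero = refl
count-arrivalOrders (suc n) = begin
  count (λ _ → true) (arrivalOrders (suc n))      ≡⟨ count-arrivalOrders-by-insertion _ n (λ _ → suc n * 1) (λ _ → allPositions) ⟩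
  sumOver (λ _ → suc n * 1) (arrivalOrders n)      ≡⟨ sumOver-* (suc n) (λ _ → 1) (arrivalOrders n) ⟩
  suc n * sumOver (λ _ → 1) (arrivalOrders n)      ≡⟨ cong (suc n *_) (count≡sumOver (λ _ → true) (arrivalOrders n)) ⟨
  suc n * count (λ _ → true) (arrivalOrders n)     ≡⟨ cong (suc n *_) (count-arrivalOrders n) ⟩
  suc n * n !                                      ∎
  where
  open ≡-Reasoning
  allPositions : sumBelow (λ _ → 1) (suc n) ≡ suc n * 1
  allPositions = sumBelow-const 1 (suc n) (λ _ _ → refl)

countAt : ℕ → ℕ → ℕ → ℕ
countAt d n a = count (λ σ → is d (nth a σ)) (arrivalOrders n)

countAt-worst : ∀ {L a} → a ≤ L → countAt (suc L) (suc L) a ≡ L !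
countAt-worst {L} {a} a≤L = begin
  countAt (suc L) (suc L) a                 ≡⟨ count-arrivalOrders-by-insertion _ L (λ _ → 1) onlyAtA ⟩
  sumOver (λ _ → 1) (arrivalOrders L)       ≡⟨ count≡sumOver (λ _ → true) (arrivalOrders L) ⟨
  count (λ _ → true) (arrivalOrders L)      ≡⟨ count-arrivalOrders L ⟩
  L !                                       ∎
  where
  open ≡-Reasoning
  d = suc L
  onlyAtA : ∀ {σ} → IsArrangement L σ → sumBelow (λ p → ⟦ is d (nth a (insAt p d σ)) ⟧) (suc L) ≡ 1
  onlyAtA {σ} (_ , σ≤L , refl) = trans
    (sumBelow-blocks {A = 0} {X = 0} {Z = 1} {Y = 0} z≤n a≤L (λ _ ())
      (λ p _ p<a → cong ⟦_⟧ (trans (cong (is d) (nth-insAt-before′ d σ p<a)) (is-∉ d (a ∸ 1) σ d∉σ)))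
      (cong ⟦_⟧ (trans (cong (is d) (nth-insAt-here d σ a≤L)) (is-just d)))
      (λ p a<p p≤L → cong ⟦_⟧ (trans (cong (is d) (nth-insAt-after d σ a<p p≤L)) (is-∉ d a σ d∉σ))))
    (cong₂ (λ u v → u + 1 + v) (*-zeroʳ a) (*-zeroʳ (L ∸ a)))
    where
    d∉σ : d ∉ σ
    d∉σ d∈σ = <-irrefl refl (All.lookup σ≤L d∈σ)

countAt-arrivalOrders : ∀ {d n a} → 1 ≤ d → d ≤ n → a < n → countAt d n a ≡ (n ∸ 1) !
countAt-arrivalOrders {d} {suc L} {a} 1≤d d≤L+1 (s≤s a≤L) with d ≟ suc L
... | yes refl = countAt-worst a≤L
... | no d≢L+1 with L
...   | zero = ⊥-elim (d≢L+1 (≤-antisym d≤L+1 1≤d))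
...   | suc L' = begin
  countAt d (2 + L') a
    ≡⟨ count-arrivalOrders-by-insertion _ (suc L') _ shifted ⟩
  sumOver (λ σ → 0 * 0 + a * ⟦ is d (nth (a ∸ 1) σ) ⟧ + 0 + (suc L' ∸ a) * ⟦ is d (nth a σ) ⟧) (arrivalOrders (suc L'))
    ≡⟨ sumOver-blocks 0 a (suc L' ∸ a) (λ _ → false) _ _ (arrivalOrders (suc L')) ⟩
  a * countAt d (suc L') (a ∸ 1) + 0 + (suc L' ∸ a) * countAt d (suc L') a
    ≡⟨ cong₂ (λ u v → u + 0 + v)
         (*-cong-pos a (λ _ → countAt-arrivalOrders 1≤d d≤L'+1 (s≤s (∸-monoˡ-≤ 1 a≤L))))
         (*-cong-pos (suc L' ∸ a) (λ 0<L-a → countAt-arrivalOrders 1≤d d≤L'+1 (0<∸⇒> 0<L-a))) ⟩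
  a * L' ! + 0 + (suc L' ∸ a) * L' !
    ≡⟨ cong (_+ (suc L' ∸ a) * L' !) (+-identityʳ (a * L' !)) ⟩
  a * L' ! + (suc L' ∸ a) * L' !
    ≡⟨ *-distribʳ-+ (L' !) a (suc L' ∸ a) ⟨
  (a + (suc L' ∸ a)) * L' !
    ≡⟨ cong (_* L' !) (m+[n∸m]≡n a≤L) ⟩
  suc L' * L' ! ∎
  where
  open ≡-Reasoning
  d≤L'+1 : d ≤ suc L'
  d≤L'+1 = ≤-pred (≤∧≢⇒< d≤L+1 d≢L+1)
  shifted : ∀ {σ} → IsArrangement (suc L') σ →
    sumBelow (λ p → ⟦ is d (nth a (insAt p (2 + L') σ)) ⟧) (2 + L') ≡
      0 * 0 + a * ⟦ is d (nth (a ∸ 1) σ) ⟧ + 0 + (suc L' ∸ a) * ⟦ is d (nth a σ) ⟧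
  shifted {σ} (_ , _ , len) = sumBelow-blocks {A = 0} z≤n a≤L (λ _ ())
    (λ p _ p<a → cong ⟦_⟧ (cong (is d) (nth-insAt-before′ (2 + L') σ p<a)))
    (cong ⟦_⟧ (trans (cong (is d) (nth-insAt-here (2 + L') σ (≤-len a≤L))) (is-≢ d (2 + L') (>⇒≢ (s≤s d≤L'+1)))))
    (λ p a<p p≤L → cong ⟦_⟧ (cong (is d) (nth-insAt-after (2 + L') σ a<p (≤-len p≤L))))
    where
    ≤-len : ∀ {p} → p ≤ suc L' → p ≤ length σ
    ≤-len = subst (_ ≤_) (sym len)

acceptedAt : ℕ → ℕ → ℕ → ℕ → ℕ → ℕ → List ℕ → Bool
acceptedAt k r d j s q σ = acceptsAs k (suc s) r d j σ ∧ is d (nth q σ)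

acceptCount : ℕ → ℕ → ℕ → ℕ → ℕ → ℕ → ℕ → ℕ
acceptCount k r d j n s q = count (acceptedAt k r d j s q) (arrivalOrders n)

module _ (k r d j : ℕ) where

  acceptsAs-insAt-late : ∀ {s p x σ} → s ≤ p → p ≤ length σ → 0 < x → All (_< x) σ →
    acceptsAs k (suc s) r d j (insAt p x σ) ≡ acceptsAs k (suc s) r d j σ
  acceptsAs-insAt-late {s} {p} {x} {σ} s≤p p≤len 0<x σ<x =
    acceptsAs-cong k r d j (suc s) (suc s) (insAt p x σ) σ (singleRef-insAt-late k r s≤p p≤len 0<x σ<x)

  -- The four blocks of positions p of x: in the sample, between the sample and v_d,
  -- at v_d's new position, and after v_d.
  acceptedAt-insAt : ∀ {s q L σ x} (A : Bool) →
    (∀ p → p ≤ s → acceptsAs k (2 + s) r d j (insAt p x σ) ≡ A) →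
    s ≤ q → suc q ≤ L → length σ ≡ L → All (_< x) σ → d < x →
    sumBelow (λ p → ⟦ acceptedAt k r d j (suc s) (suc q) (insAt p x σ) ⟧) (suc L) ≡
      suc s * ⟦ A ∧ is d (nth q σ) ⟧ + (q ∸ s) * ⟦ acceptedAt k r d j (suc s) q σ ⟧ + 0
        + (L ∸ suc q) * ⟦ acceptedAt k r d j (suc s) (suc q) σ ⟧
  acceptedAt-insAt {s} {q} {L} {σ} {x} A inSample s≤q q<L refl σ<x d<x =
    sumBelow-blocks (s≤s s≤q) q<L sample between atItem after
    where
    0<x : 0 < x
    0<x = <-≤-trans z<s d<x
    sample : ∀ p → p < suc s → ⟦ acceptedAt k r d j (suc s) (suc q) (insAt p x σ) ⟧ ≡ ⟦ A ∧ is d (nth q σ) ⟧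
    sample p (s≤s p≤s) = cong ⟦_⟧ (cong₂ _∧_ (inSample p p≤s) (cong (is d) (nth-insAt-before x σ (≤-trans p≤s s≤q))))
    between : ∀ p → suc s ≤ p → p < suc q →
      ⟦ acceptedAt k r d j (suc s) (suc q) (insAt p x σ) ⟧ ≡ ⟦ acceptedAt k r d j (suc s) q σ ⟧
    between p s<p (s≤s p≤q) = cong ⟦_⟧ (cong₂ _∧_
      (acceptsAs-insAt-late s<p (≤-trans p≤q (<⇒≤ q<L)) 0<x σ<x)
      (cong (is d) (nth-insAt-before x σ p≤q)))
    atItem : ⟦ acceptedAt k r d j (suc s) (suc q) (insAt (suc q) x σ) ⟧ ≡ 0
    atItem = cong ⟦_⟧ (trans (cong (acceptsAs k (2 + s) r d j (insAt (suc q) x σ) ∧_)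
             (trans (cong (is d) (nth-insAt-here x σ q<L)) (is-≢ d x (>⇒≢ d<x))))
           (∧-zeroʳ _))
    after : ∀ p → suc q < p → p ≤ L →
      ⟦ acceptedAt k r d j (suc s) (suc q) (insAt p x σ) ⟧ ≡ ⟦ acceptedAt k r d j (suc s) (suc q) σ ⟧
    after p q<p p≤L = cong ⟦_⟧ (cong₂ _∧_
      (acceptsAs-insAt-late (≤-trans (s≤s s≤q) (<⇒≤ q<p)) p≤L 0<x σ<x)
      (cong (is d) (nth-insAt-after x σ q<p p≤L)))

  acceptCount-suc : ∀ {s q L} → 1 ≤ r → r ≤ s → d ≤ r → s ≤ q → suc q ≤ L →
    acceptCount k r d j (suc L) (suc s) (suc q) ≡
      suc s * acceptCount k r d j L s q + (q ∸ s) * acceptCount k r d j L (suc s) q + 0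
        + (L ∸ suc q) * acceptCount k r d j L (suc s) (suc q)
  acceptCount-suc {s} {q} {L} 1≤r r≤s d≤r s≤q q<L = trans
    (count-arrivalOrders-by-insertion _ L _ λ {σ} (_ , σ≤L , len) →
      acceptedAt-insAt (acceptsAs k (suc s) r d j σ)
        (λ p p≤s → acceptsAs-cong k r d j (2 + s) (suc s) (insAt p (suc L) σ) σ
          (singleRef-insAt-sample k r 1≤r r≤s p≤s (subst (s ≤_) (sym len) (≤-trans s≤q (<⇒≤ q<L))) (All.map s≤s σ≤L)))
        s≤q q<L len (All.map s≤s σ≤L) (s≤s (≤-trans d≤r (≤-trans r≤s (≤-trans s≤q (<⇒≤ q<L))))))
    (sumOver-blocks (suc s) (q ∸ s) (L ∸ suc q) _ _ _ (arrivalOrders L))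

  acceptCount-suc-reference : ∀ {r' q L} → j < k → r ≡ suc r' → d ≤ r → r' ≤ q → suc q ≤ L →
    acceptCount k r d j (suc L) r (suc q) ≡
      r * count (λ σ → is d (nth (r' + j) σ) ∧ is d (nth q σ)) (arrivalOrders L)
        + (q ∸ r') * acceptCount k r d j L r q + 0 + (L ∸ suc q) * acceptCount k r d j L r (suc q)
  acceptCount-suc-reference {r'} {q} {L} j<k refl d≤r r'≤q q<L = trans
    (count-arrivalOrders-by-insertion _ L _ λ {σ} (_ , σ≤L , len) →
      acceptedAt-insAt (is d (nth (r' + j) σ))
        (λ p p≤r' → trans (acceptsAs≡ k (2 + r') r d j (insAt p (suc L) σ)) (cong (is d) (begin
          nth j (singleRef k (2 + r') r (insAt p (suc L) σ))
            ≡⟨ cong (nth j) (singleRef-insAt-reference k p≤r' (subst (r' ≤_) (sym len) (≤-trans r'≤q (<⇒≤ q<L))) (All.map s≤s σ≤L)) ⟩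
          nth j (take k (drop r' σ))   ≡⟨ nth-take (drop r' σ) j<k ⟩
          nth j (drop r' σ)            ≡⟨ nth-drop r' j σ ⟩
          nth (r' + j) σ               ∎)))
        r'≤q q<L len (All.map s≤s σ≤L) (s≤s (≤-trans d≤r (≤-trans (s≤s r'≤q) q<L))))
    (sumOver-blocks r (q ∸ r') (L ∸ suc q) _ _ _ (arrivalOrders L))
    where open ≡-Reasoning

-- Falling factorials and binomial coefficients

fall-suc : ∀ a b → fall a (suc b) ≡ fall a b * (a ∸ b)
fall-suc a zero = trans (*-identityʳ a) (sym (+-identityʳ a))
fall-suc a (suc b) = trans (cong (a *_) (fall-suc (a ∸ 1) b))
  (trans (sym (*-assoc a (fall (a ∸ 1) b) (a ∸ 1 ∸ b))) (cong (a * fall (a ∸ 1) b *_) (∸-+-assoc a 1 b)))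

fall-< : ∀ {a b} → a < b → fall a b ≡ 0
fall-< {zero} {suc b} _ = refl
fall-< {suc a} {suc b} (s≤s a<b) = trans (cong (suc a *_) (fall-< a<b)) (*-zeroʳ (suc a))

fall-self : ∀ n → fall n n ≡ n !
fall-self zero = refl
fall-self (suc n) = cong (suc n *_) (fall-self n)

fall-*-! : ∀ a b → fall (a + b) b * a ! ≡ (a + b) !
fall-*-! a zero = trans (+-identityʳ (a !)) (cong _! (sym (+-identityʳ a)))
fall-*-! a (suc b) rewrite +-suc a b = trans (*-assoc (suc (a + b)) (fall (a + b) b) (a !)) (cong (suc (a + b) *_) (fall-*-! a b))

fall-pos : ∀ {q m} → m ≤ q → 0 < fall q m
fall-pos {m = zero} _ = z<s
fall-pos {suc q} {suc m} (s≤s m≤q) = *-mono-≤ {1} {suc q} (s≤s z≤n) (fall-pos m≤q)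

fall-suc-base : ∀ x e → fall (suc x) e ≡ fall x e + e * fall x (pred e)
fall-suc-base x zero = refl
fall-suc-base x (suc e) with e ≤? x
... | yes e≤x = sym (begin
  fall x (suc e) + suc e * fall x e   ≡⟨ cong (_+ suc e * fall x e) (fall-suc x e) ⟩
  fall x e * (x ∸ e) + suc e * fall x e ≡⟨ factor (fall x e) (x ∸ e) e ⟩
  fall x e * suc (x ∸ e + e)           ≡⟨ cong (λ m → fall x e * suc m) (m∸n+n≡m e≤x) ⟩
  fall x e * suc x                     ≡⟨ *-comm (fall x e) (suc x) ⟩
  suc x * fall x e                     ∎)
  where
  open ≡-Reasoning
  factor : ∀ f a e → f * a + suc e * f ≡ f * suc (a + e)
  factor = solve-∀
... | no e≰x = trans (cong (suc x *_) (fall-< x<e))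
  (trans (*-zeroʳ (suc x)) (sym (trans (cong₂ (λ u v → u + suc e * v) (fall-< (m<n⇒m<1+n x<e)) (fall-< x<e)) (*-zeroʳ (suc e)))))
  where
  x<e : x < e
  x<e = ≰⇒> e≰x

suc-*-C : ∀ n j → suc n * (n C j) ≡ (suc n ∸ j) * (suc n C j)
suc-*-C n zero = refl
suc-*-C zero (suc j) = trans (cong (1 *_) (k>n⇒nCk≡0 {0} {suc j} z<s)) (cong (_* (1 C suc j)) (sym (0∸n≡0 j)))
suc-*-C (suc n) (suc j) = begin
  suc (suc n) * (suc n C suc j)
    ≡⟨ cong (suc (suc n) *_) (pascal n j) ⟨
  suc (suc n) * (n C j + n C suc j)
    ≡⟨ expand (suc n) (n C j) (n C suc j) ⟩
  (suc n * (n C j) + (n C j + n C suc j)) + suc n * (n C suc j)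
    ≡⟨ cong₂ (λ u v → (u + (n C j + n C suc j)) + v) (suc-*-C n j) (suc-*-C n (suc j)) ⟩
  ((suc n ∸ j) * (suc n C j) + (n C j + n C suc j)) + (n ∸ j) * (suc n C suc j)
    ≡⟨ cong (λ c → (suc n ∸ j) * (suc n C j) + c + (n ∸ j) * (suc n C suc j)) (pascal n j) ⟩
  ((suc n ∸ j) * (suc n C j) + suc n C suc j) + (n ∸ j) * (suc n C suc j)
    ≡⟨ collect ⟩
  (suc n ∸ j) * (suc n C j + suc n C suc j)
    ≡⟨ cong ((suc n ∸ j) *_) (pascal (suc n) j) ⟩
  (suc n ∸ j) * (suc (suc n) C suc j) ∎
  where
  open ≡-Reasoning
  pascal = nCk+nC[k+1]≡[n+1]C[k+1]
  expand : ∀ a x y → suc a * (x + y) ≡ (a * x + (x + y)) + a * y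
  expand = solve-∀
  collect : (suc n ∸ j) * (suc n C j) + suc n C suc j + (n ∸ j) * (suc n C suc j) ≡ (suc n ∸ j) * (suc n C j + suc n C suc j)
  collect with j ≤? n
  ... | yes j≤n = trans (cong (λ u → u * (suc n C j) + suc n C suc j + (n ∸ j) * (suc n C suc j)) n+1-j)
      (trans (distrib (n ∸ j) (suc n C j) (suc n C suc j)) (cong (_* (suc n C j + suc n C suc j)) (sym n+1-j)))
    where
    n+1-j : suc n ∸ j ≡ suc (n ∸ j)
    n+1-j = +-∸-assoc 1 j≤n
    distrib : ∀ u a b → suc u * a + b + u * b ≡ suc u * (a + b)
    distrib = solve-∀
  ... | no j≰n = trans (cong (λ c → (suc n ∸ j) * (suc n C j) + c + (n ∸ j) * c) vanish)
      (trans (drop0 (suc n ∸ j) (suc n C j) (n ∸ j)) (cong (λ c → (suc n ∸ j) * (suc n C j + c)) (sym vanish)))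
    where
    vanish : suc n C suc j ≡ 0
    vanish = k>n⇒nCk≡0 (s≤s (≰⇒> j≰n))
    drop0 : ∀ u a v → u * a + 0 + v * 0 ≡ u * (a + 0)
    drop0 = solve-∀

*-pred-C : ∀ a j → a * (pred a C j) ≡ (a ∸ j) * (a C j)
*-pred-C zero j = cong (_* (0 C j)) (sym (0∸n≡0 j))
*-pred-C (suc a) j = suc-*-C a j

-- The closed form

κ : ℕ → ℕ → ℕ
κ r j = fall (r ∸ 1 + j) j

-- With i = q + 1 and t = s + 1 this is κ τ C(i-t, j) (n-1)! / (i-1)^(r+j): the last two
-- factors are (n-1)! / q^(r+j) written without division.
closedForm : ℕ → ℕ → ℕ → ℕ → ℕ → ℕ
closedForm r j n s q = κ r j * fall s r * ((q ∸ s) C j) * (q ∸ (r + j)) ! * fall (n ∸ 1) (n ∸ 1 ∸ q)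

closedForm-≡ : ∀ r j n s q {c W X} → (q ∸ s) C j ≡ c → (q ∸ (r + j)) ! ≡ W → fall (n ∸ 1) (n ∸ 1 ∸ q) ≡ X →
  closedForm r j n s q ≡ κ r j * fall s r * c * W * X
closedForm-≡ r j n s q refl refl refl = refl

closedForm-< : ∀ r j n s q → q ∸ s < j → closedForm r j n s q ≡ 0
closedForm-< r j n s q q-s<j = trans (closedForm-≡ r j n s q (k>n⇒nCk≡0 q-s<j) refl refl) (vanish (κ r j) (fall s r) _ _)
  where
  vanish : ∀ a b c d → a * b * 0 * c * d ≡ 0
  vanish = solve-∀

vanishing : ∀ x y z {u v w} → u ≡ 0 → v ≡ 0 → w ≡ 0 → x * u + y * v + 0 + z * w ≡ 0
vanishing x y z refl refl refl = zeros x y z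
  where
  zeros : ∀ x y z → x * 0 + y * 0 + 0 + z * 0 ≡ 0
  zeros = solve-∀

fall-tail : ∀ q e {L} → L ≡ suc (q + e) → fall (L ∸ 1) (L ∸ 1 ∸ q) ≡ fall (q + e) e
fall-tail q e refl = cong (fall (q + e)) (m+n∸m≡n q e)

fall-tail-suc : ∀ q e {L} → L ≡ suc (q + e) → fall (L ∸ 1) (L ∸ 1 ∸ suc q) ≡ fall (q + e) (pred e)
fall-tail-suc q e refl = cong (fall (q + e)) (trans (sym (pred[m∸n]≡m∸[1+n] (q + e) q)) (cong pred (m+n∸m≡n q e)))

fall-tail-insert : ∀ q e {L} → L ≡ suc (q + e) → fall L e ≡ fall (q + e) e + e * fall (q + e) (pred e)
fall-tail-insert q e refl = fall-suc-base (q + e) e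

-- The three blocks of the recursion come from (s+1) s^(r) = (s+1)^(r) (s+1-r),
-- a C(a-1, j) = (a-j) C(a, j) for a = q - s, and L^(e) = (L-1)^(e) + e (L-1)^(e-1).
closedForm-suc : ∀ r j {s q L} → r ≤ s → s ≤ q → suc q ≤ L →
  closedForm r j (suc L) (suc s) (suc q) ≡
    suc s * closedForm r j L s q + (q ∸ s) * closedForm r j L (suc s) q + 0 + (L ∸ suc q) * closedForm r j L (suc s) (suc q)
closedForm-suc r j {s} {q} {L} r≤s s≤q q<L with j ≤? q ∸ s
... | no j≰a = trans (closedForm-< r j (suc L) (suc s) (suc q) a<j) (sym (vanishing (suc s) (q ∸ s) (L ∸ suc q)
  (closedForm-< r j L s q a<j)
  (closedForm-< r j L (suc s) q (≤-<-trans (∸-monoʳ-≤ q (n≤1+n s)) a<j))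
  (closedForm-< r j L (suc s) (suc q) a<j)))
  where
  a<j : q ∸ s < j
  a<j = ≰⇒> j≰a
... | yes j≤a = begin
  closedForm r j (suc L) (suc s) (suc q)
    ≡⟨ closedForm-≡ r j (suc L) (suc s) (suc q) refl (cong _! q+1-[r+j]) (fall-tail-insert q e L≡) ⟩
  K * A * c * ((u + v) * W) * (X + e * Y)
    ≡⟨ expand K A c W X Y e u v ⟩
  K * c * W * X * (A * u) + K * A * W * X * (v * c) + 0 + e * (K * A * c * ((u + v) * W) * Y)
    ≡⟨ cong₂ (λ p p′ → K * c * W * X * p + K * A * W * X * p′ + 0 + e * (K * A * c * ((u + v) * W) * Y))
         (sym [s+1]B≡Au) (sym (*-pred-C a j)) ⟩
  K * c * W * X * (suc s * B) + K * A * W * X * (a * c′) + 0 + e * (K * A * c * ((u + v) * W) * Y)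
    ≡⟨ regroup K A B c c′ W X e (suc s) a (K * A * c * ((u + v) * W) * Y) ⟩
  suc s * (K * B * c * W * X) + a * (K * A * c′ * W * X) + 0 + e * (K * A * c * ((u + v) * W) * Y)
    ≡⟨ trans (cong₂ (λ p p′ → suc s * p + a * p′ + 0 + e * closedForm r j L (suc s) (suc q))
         (closedForm-≡ r j L s q refl (cong _! q-[r+j]) (fall-tail q e L≡))
         (closedForm-≡ r j L (suc s) q (cong (_C j) (sym (pred[m∸n]≡m∸[1+n] q s))) (cong _! q-[r+j]) (fall-tail q e L≡)))
       (cong (λ p → suc s * (K * B * c * W * X) + a * (K * A * c′ * W * X) + 0 + e * p)
         (closedForm-≡ r j L (suc s) (suc q) refl (cong _! q+1-[r+j]) (fall-tail-suc q e L≡))) ⟨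
  suc s * closedForm r j L s q + a * closedForm r j L (suc s) q + 0 + e * closedForm r j L (suc s) (suc q) ∎
  where
  open ≡-Reasoning
  K = κ r j
  A = fall (suc s) r
  B = fall s r
  a = q ∸ s
  e = L ∸ suc q
  c = a C j
  c′ = pred a C j
  u = suc (s ∸ r)
  v = a ∸ j
  W = (s ∸ r + v) !
  X = fall (q + e) e
  Y = fall (q + e) (pred e)
  L≡ : L ≡ suc (q + e)
  L≡ = sym (m+[n∸m]≡n q<L)
  [s+1]B≡Au : suc s * B ≡ A * u
  [s+1]B≡Au = trans (fall-suc (suc s) r) (cong (A *_) (+-∸-assoc 1 r≤s))
  q≡ : q ≡ (r + j) + (s ∸ r + v)
  q≡ = trans (sym (m+[n∸m]≡n s≤q)) (trans (cong₂ _+_ (sym (m+[n∸m]≡n r≤s)) (sym (m+[n∸m]≡n j≤a))) (shuffle r (s ∸ r) j v))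
    where
    shuffle : ∀ r x j v → r + x + (j + v) ≡ r + j + (x + v)
    shuffle = solve-∀
  q-[r+j] : q ∸ (r + j) ≡ s ∸ r + v
  q-[r+j] = trans (cong (_∸ (r + j)) q≡) (m+n∸m≡n (r + j) _)
  q+1-[r+j] : suc q ∸ (r + j) ≡ u + v
  q+1-[r+j] = trans (cong (λ m → suc m ∸ (r + j)) q≡)
    (trans (cong (_∸ (r + j)) (sym (+-suc (r + j) _))) (m+n∸m≡n (r + j) (suc (s ∸ r + v))))
  expand : ∀ K A c W X Y e u v → K * A * c * ((u + v) * W) * (X + e * Y) ≡
    K * c * W * X * (A * u) + K * A * W * X * (v * c) + 0 + e * (K * A * c * ((u + v) * W) * Y)
  expand = solve-∀
  regroup : ∀ K A B c c′ W X e s′ a T → K * c * W * X * (s′ * B) + K * A * W * X * (a * c′) + 0 + e * T ≡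
    s′ * (K * B * c * W * X) + a * (K * A * c′ * W * X) + 0 + e * T
  regroup = solve-∀

closedForm-suc-reference-≡ : ∀ r' j {q L} → r' + j ≡ q → suc q ≤ L →
  closedForm (suc r') j (suc L) (suc r') (suc q) ≡
    suc r' * (L ∸ 1) ! + (q ∸ r') * closedForm (suc r') j L (suc r') q + 0
      + (L ∸ suc q) * closedForm (suc r') j L (suc r') (suc q)
closedForm-suc-reference-≡ r' j {q} {L} refl q<L = begin
  closedForm r j (suc L) r (suc q)
    ≡⟨ closedForm-≡ r j (suc L) r (suc q) jCj≡1 (cong _! (n∸n≡0 q)) (fall-tail-insert q e L≡) ⟩
  K * A * 1 * 1 * (X + e * Y)
    ≡⟨ expand K A X Y e ⟩
  K * A * X + e * (K * A * 1 * 1 * Y)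
    ≡⟨ cong (_+ e * (K * A * 1 * 1 * Y)) KAX≡ ⟩
  r * (L ∸ 1) ! + e * (K * A * 1 * 1 * Y)
    ≡⟨ dropZero (r * (L ∸ 1) !) (e * (K * A * 1 * 1 * Y)) middle ⟨
  r * (L ∸ 1) ! + a * (K * A * c′ * 1 * X) + 0 + e * (K * A * 1 * 1 * Y)
    ≡⟨ cong₂ (λ m m′ → r * (L ∸ 1) ! + a * m + 0 + e * m′)
         (closedForm-≡ r j L r q (cong (_C j) (sym (pred[m∸n]≡m∸[1+n] q r'))) (cong _! (m≤n⇒m∸n≡0 (n≤1+n q))) (fall-tail q e L≡))
         (closedForm-≡ r j L r (suc q) jCj≡1 (cong _! (n∸n≡0 q)) (fall-tail-suc q e L≡)) ⟨
  r * (L ∸ 1) ! + a * closedForm r j L r q + 0 + e * closedForm r j L r (suc q) ∎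
  where
  open ≡-Reasoning
  r = suc r'
  K = κ r j
  A = fall r r
  a = q ∸ r'
  e = L ∸ suc q
  c′ = pred a C j
  X = fall (q + e) e
  Y = fall (q + e) (pred e)
  L≡ : L ≡ suc (q + e)
  L≡ = sym (m+[n∸m]≡n q<L)
  a≡j : a ≡ j
  a≡j = m+n∸m≡n r' j
  jCj≡1 : a C j ≡ 1
  jCj≡1 = trans (cong (_C j) a≡j) (nCn≡1 j)
  middle : a * (K * A * c′ * 1 * X) ≡ 0
  middle = trans (scale a c′ K A X)
    (cong (_* (K * A * X)) (trans (*-pred-C a j) (trans (cong (λ m → (m ∸ j) * (a C j)) a≡j) (cong (_* (a C j)) (n∸n≡0 j)))))
    where
    scale : ∀ j c K A X → j * (K * A * c * 1 * X) ≡ j * c * (K * A * X)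
    scale = solve-∀
  KAX≡ : K * A * X ≡ r * (L ∸ 1) !
  KAX≡ = begin
    K * (r * fall r' r') * X    ≡⟨ cong (λ m → K * (r * m) * X) (fall-self r') ⟩
    K * (r * r' !) * X           ≡⟨ reorder K r (r' !) X ⟩
    r * ((K * r' !) * X)         ≡⟨ cong (λ m → r * (m * X)) (fall-*-! r' j) ⟩
    r * (q ! * X)                ≡⟨ cong (r *_) (trans (*-comm (q !) X) (fall-*-! q e)) ⟩
    r * (q + e) !                ≡⟨ cong (λ m → r * (m ∸ 1) !) L≡ ⟨
    r * (L ∸ 1) !                ∎
    where
    reorder : ∀ K R F X → K * (R * F) * X ≡ R * ((K * F) * X)
    reorder = solve-∀
  expand : ∀ K A X Y e → K * A * 1 * 1 * (X + e * Y) ≡ K * A * X + e * (K * A * 1 * 1 * Y)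
  expand = solve-∀
  dropZero : ∀ R T {m} → m ≡ 0 → R + m + 0 + T ≡ R + T
  dropZero R T refl = cong (_+ T) (trans (+-identityʳ (R + 0)) (+-identityʳ R))

closedForm-suc-reference-≢ : ∀ r' j {q L} → r' + j ≢ q → r' ≤ q → suc q ≤ L →
  closedForm (suc r') j (suc L) (suc r') (suc q) ≡
    suc r' * 0 + (q ∸ r') * closedForm (suc r') j L (suc r') q + 0
      + (L ∸ suc q) * closedForm (suc r') j L (suc r') (suc q)
closedForm-suc-reference-≢ r' j {q} {L} r'+j≢q r'≤q q<L with j ≤? q ∸ r'
... | no j≰a = trans (closedForm-< r j (suc L) (suc r') (suc q) a<j) (sym (vanishing (suc r') (q ∸ r') (L ∸ suc q) refl
  (closedForm-< r j L (suc r') q (≤-<-trans (∸-monoʳ-≤ q (n≤1+n r')) a<j))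
  (closedForm-< r j L (suc r') (suc q) a<j)))
  where
  r = suc r'
  a<j : q ∸ r' < j
  a<j = ≰⇒> j≰a
... | yes j≤a = begin
  closedForm r j (suc L) r (suc q)
    ≡⟨ closedForm-≡ r j (suc L) r (suc q) refl (cong _! q+1-[r+j]) (fall-tail-insert q e L≡) ⟩
  K * A * c * (suc w * W) * (X + e * Y)
    ≡⟨ expand K A c W X Y e w r ⟩
  r * 0 + (suc w * c) * (K * A * W * X) + 0 + e * (K * A * c * (suc w * W) * Y)
    ≡⟨ cong (λ m → r * 0 + m * (K * A * W * X) + 0 + e * (K * A * c * (suc w * W) * Y)) a*c′≡ ⟨
  r * 0 + (a * c′) * (K * A * W * X) + 0 + e * (K * A * c * (suc w * W) * Y)
    ≡⟨ regroup K A c′ W X e r a (K * A * c * (suc w * W) * Y) ⟩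
  r * 0 + a * (K * A * c′ * W * X) + 0 + e * (K * A * c * (suc w * W) * Y)
    ≡⟨ cong₂ (λ m m′ → r * 0 + a * m + 0 + e * m′)
         (closedForm-≡ r j L r q (cong (_C j) (sym (pred[m∸n]≡m∸[1+n] q r'))) (cong _! q-[r+j]) (fall-tail q e L≡))
         (closedForm-≡ r j L r (suc q) refl (cong _! q+1-[r+j]) (fall-tail-suc q e L≡)) ⟨
  r * 0 + a * closedForm r j L r q + 0 + e * closedForm r j L r (suc q) ∎
  where
  open ≡-Reasoning
  r = suc r'
  K = κ r j
  A = fall r r
  a = q ∸ r'
  e = L ∸ suc q
  c = a C j
  c′ = pred a C j
  j<a : j < a
  j<a = ≤∧≢⇒< j≤a (λ j≡a → r'+j≢q (trans (cong (r' +_) j≡a) (m+[n∸m]≡n r'≤q)))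
  w = a ∸ suc j
  W = w !
  X = fall (q + e) e
  Y = fall (q + e) (pred e)
  L≡ : L ≡ suc (q + e)
  L≡ = sym (m+[n∸m]≡n q<L)
  a*c′≡ : a * c′ ≡ suc w * c
  a*c′≡ = trans (*-pred-C a j) (cong (_* c) (+-∸-assoc 1 j<a))
  q≡ : q ≡ suc (r' + j) + w
  q≡ = trans (sym (m+[n∸m]≡n r'≤q)) (trans (cong (r' +_) (sym (m+[n∸m]≡n j<a))) (shuffle r' j w))
    where
    shuffle : ∀ r' j w → r' + (suc j + w) ≡ suc (r' + j) + w
    shuffle = solve-∀
  q-[r+j] : q ∸ (r + j) ≡ w
  q-[r+j] = trans (cong (_∸ (r + j)) q≡) (m+n∸m≡n (r + j) w)
  q+1-[r+j] : suc q ∸ (r + j) ≡ suc w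
  q+1-[r+j] = trans (cong (_∸ (r' + j)) q≡) (trans (cong (_∸ (r' + j)) (sym (+-suc (r' + j) w))) (m+n∸m≡n (r' + j) (suc w)))
  expand : ∀ K A c W X Y e w r → K * A * c * (suc w * W) * (X + e * Y) ≡
    r * 0 + (suc w * c) * (K * A * W * X) + 0 + e * (K * A * c * (suc w * W) * Y)
  expand = solve-∀
  regroup : ∀ K A c′ W X e r a T → r * 0 + (a * c′) * (K * A * W * X) + 0 + e * T ≡ r * 0 + a * (K * A * c′ * W * X) + 0 + e * T
  regroup = solve-∀

count-∧-nth : ∀ d {a b} L → a ≢ b → count (λ σ → is d (nth a σ) ∧ is d (nth b σ)) (arrivalOrders L) ≡ 0
count-∧-nth d {a} {b} L a≢b = trans (count-cong (arrivalOrders L) (arrivalOrders-arrangement L) never) (count-false (arrivalOrders L))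
  where
  never : ∀ {σ} → IsArrangement L σ → (is d (nth a σ) ∧ is d (nth b σ)) ≡ false
  never {σ} (unique , _) with is d (nth a σ) in atA | is d (nth b σ) in atB
  ... | true | true = ⊥-elim (a≢b (nth-unique σ unique (is-true d _ atA) (is-true d _ atB)))
  ... | true | false = refl
  ... | false | _ = refl

module _ {k r d j : ℕ} (j<k : j < k) (1≤d : 1 ≤ d) (d≤r : d ≤ r) where

  acceptCount≡closedForm : ∀ n {s q} → r ≤ s → s ≤ q → q < n → acceptCount k r d j n s q ≡ closedForm r j n s q
  acceptCount≡closedForm (suc L) {zero} r≤0 _ _ with () ← ≤-trans (≤-trans 1≤d d≤r) r≤0
  acceptCount≡closedForm (suc L) {suc s} {suc q} r≤s+1 (s≤s s≤q) (s≤s q<L) with r ≟ suc s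
  ... | no r≢s+1 = begin
    acceptCount k r d j (suc L) (suc s) (suc q)
      ≡⟨ acceptCount-suc k r d j (≤-trans 1≤d d≤r) r≤s d≤r s≤q q<L ⟩
    suc s * acceptCount k r d j L s q + (q ∸ s) * acceptCount k r d j L (suc s) q + 0
      + (L ∸ suc q) * acceptCount k r d j L (suc s) (suc q)
      ≡⟨ cong₂ (λ u v → suc s * u + v + 0 + (L ∸ suc q) * acceptCount k r d j L (suc s) (suc q))
           (IH r≤s s≤q q<L) (*-cong-pos (q ∸ s) (λ 0<q-s → IH r≤s+1 (0<∸⇒> 0<q-s) q<L)) ⟩
    suc s * closedForm r j L s q + (q ∸ s) * closedForm r j L (suc s) q + 0
      + (L ∸ suc q) * acceptCount k r d j L (suc s) (suc q)
      ≡⟨ cong (λ v → suc s * closedForm r j L s q + (q ∸ s) * closedForm r j L (suc s) q + 0 + v)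
           (*-cong-pos (L ∸ suc q) (λ 0<L-q-1 → IH r≤s+1 (s≤s s≤q) (0<∸⇒> 0<L-q-1))) ⟩
    suc s * closedForm r j L s q + (q ∸ s) * closedForm r j L (suc s) q + 0
      + (L ∸ suc q) * closedForm r j L (suc s) (suc q)
      ≡⟨ closedForm-suc r j r≤s s≤q q<L ⟨
    closedForm r j (suc L) (suc s) (suc q) ∎
    where
    open ≡-Reasoning
    IH : ∀ {s q} → r ≤ s → s ≤ q → q < L → acceptCount k r d j L s q ≡ closedForm r j L s q
    IH = acceptCount≡closedForm L
    r≤s : r ≤ s
    r≤s = ≤-pred (≤∧≢⇒< r≤s+1 r≢s+1)
  ... | yes refl = begin
    acceptCount k r d j (suc L) r (suc q)
      ≡⟨ acceptCount-suc-reference k r d j j<k refl d≤r s≤q q<L ⟩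
    r * both + (q ∸ s) * acceptCount k r d j L r q + 0 + (L ∸ suc q) * acceptCount k r d j L r (suc q)
      ≡⟨ cong₂ (λ u v → r * both + u + 0 + v)
           (*-cong-pos (q ∸ s) (λ 0<q-s → acceptCount≡closedForm L ≤-refl (0<∸⇒> 0<q-s) q<L))
           (*-cong-pos (L ∸ suc q) (λ 0<L-q-1 → acceptCount≡closedForm L ≤-refl (s≤s s≤q) (0<∸⇒> 0<L-q-1))) ⟩
    r * both + (q ∸ s) * closedForm r j L r q + 0 + (L ∸ suc q) * closedForm r j L r (suc q)
      ≡⟨ closedForm-suc-reference ⟨
    closedForm r j (suc L) r (suc q) ∎
    where
    open ≡-Reasoning
    both = count (λ σ → is d (nth (s + j) σ) ∧ is d (nth q σ)) (arrivalOrders L)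
    withBoth : ∀ {c} → both ≡ c → r * c + (q ∸ s) * closedForm r j L r q + 0 + (L ∸ suc q) * closedForm r j L r (suc q)
                                 ≡ r * both + (q ∸ s) * closedForm r j L r q + 0 + (L ∸ suc q) * closedForm r j L r (suc q)
    withBoth refl = refl
    closedForm-suc-reference : closedForm r j (suc L) r (suc q) ≡
      r * both + (q ∸ s) * closedForm r j L r q + 0 + (L ∸ suc q) * closedForm r j L r (suc q)
    closedForm-suc-reference with s + j ≟ q
    ... | yes refl = trans (closedForm-suc-reference-≡ s j refl q<L) (withBoth (trans
      (count-cong (arrivalOrders L) (arrivalOrders-arrangement L) (λ _ → ∧-idem _))
      (countAt-arrivalOrders 1≤d (≤-trans d≤r (≤-trans (s≤s s≤q) q<L)) q<L)))
    ... | no s+j≢q = trans (closedForm-suc-reference-≢ s j s+j≢q s≤q q<L) (withBoth (count-∧-nth d L s+j≢q))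

toℚᵘ-÷ℕ : ∀ a b → toℚᵘ (a ÷ℕ suc b) ≃ mkℚᵘ (pos a) b
toℚᵘ-÷ℕ a b = ℚ.toℚᵘ-fromℚᵘ (mkℚᵘ (pos a) b)

÷ℕ-cross : ∀ a b c d → a * suc d ≡ c * suc b → a ÷ℕ suc b ≡ c ÷ℕ suc d
÷ℕ-cross a b c d eq = ℚ.fromℚᵘ-cong {mkℚᵘ (pos a) b} {mkℚᵘ (pos c) d}
  (*≡* (trans (sym (ℤ.pos-* a (suc d))) (trans (cong pos eq) (ℤ.pos-* c (suc b)))))

÷ℕ-+ : ∀ a b d → (a ÷ℕ suc d) +ℚ (b ÷ℕ suc d) ≡ (a + b) ÷ℕ suc d
÷ℕ-+ a b d = trans (ℚ.toℚᵘ-injective (ℚᵘ.≃-trans (ℚ.toℚᵘ-homo-+ (a ÷ℕ suc d) (b ÷ℕ suc d))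
    (ℚᵘ.≃-trans (ℚᵘ.+-cong (toℚᵘ-÷ℕ a d) (toℚᵘ-÷ℕ b d))
    (ℚᵘ.≃-trans (ℚᵘ.≃-reflexive sum) (ℚᵘ.≃-sym (toℚᵘ-÷ℕ _ _))))))
  (÷ℕ-cross (a * suc d + b * suc d) (d + d * suc d) (a + b) d (cancel a b (suc d)))
  where
  sum : mkℚᵘ (pos a) d ℚᵘ.+ mkℚᵘ (pos b) d ≡ mkℚᵘ (pos (a * suc d + b * suc d)) (d + d * suc d)
  sum = cong (λ z → mkℚᵘ z (d + d * suc d))
    (trans (cong₂ ℤ._+_ (sym (ℤ.pos-* a (suc d))) (sym (ℤ.pos-* b (suc d)))) (sym (ℤ.pos-+ (a * suc d) (b * suc d))))
  cancel : ∀ a b D → (a * D + b * D) * D ≡ (a + b) * (D * D)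
  cancel = solve-∀

÷ℕ-* : ∀ a b c d → (a ÷ℕ suc b) *ℚ (c ÷ℕ suc d) ≡ (a * c) ÷ℕ (suc b * suc d)
÷ℕ-* a b c d = ℚ.toℚᵘ-injective (ℚᵘ.≃-trans (ℚ.toℚᵘ-homo-* (a ÷ℕ suc b) (c ÷ℕ suc d))
  (ℚᵘ.≃-trans (ℚᵘ.*-cong (toℚᵘ-÷ℕ a b) (toℚᵘ-÷ℕ c d))
  (ℚᵘ.≃-trans (ℚᵘ.≃-reflexive (cong (λ z → mkℚᵘ z (d + b * suc d)) (sym (ℤ.pos-* a c)))) (ℚᵘ.≃-sym (toℚᵘ-÷ℕ _ _)))))

sumQ-empty : ∀ f b → sumQ f (suc b) b ≡ 0ℚ
sumQ-empty f b with b ∸ b | n∸n≡0 b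
... | _ | refl = refl

sumQ-snoc : ∀ f lo hi → lo ≤ suc hi → sumQ f lo (suc hi) ≡ sumQ f lo hi +ℚ f (suc hi)
sumQ-snoc f lo hi lo≤hi+1 with suc (suc hi) ∸ lo | +-∸-assoc 1 lo≤hi+1
... | _ | refl = cong (λ i → sumQ f lo hi +ℚ f i) (m+[n∸m]≡n lo≤hi+1)

*-sumQ : ∀ {f x g N b} M → 0 < N → (∀ u → u < M → x *ℚ f (suc b + u) ≡ g u ÷ℕ N) →
  x *ℚ sumQ f (suc b) (b + M) ≡ sumBelow g M ÷ℕ N
*-sumQ {f} {x} {g} {suc D} {b} zero _ _ = begin
  x *ℚ sumQ f (suc b) (b + 0) ≡⟨ cong (λ i → x *ℚ sumQ f (suc b) i) (+-identityʳ b) ⟩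
  x *ℚ sumQ f (suc b) b       ≡⟨ cong (x *ℚ_) (sumQ-empty f b) ⟩
  x *ℚ 0ℚ                     ≡⟨ ℚ.*-zeroʳ x ⟩
  0ℚ                          ≡⟨ ℚ.0/n≡0 (suc D) ⟨
  0 ÷ℕ suc D                  ∎
  where open ≡-Reasoning
*-sumQ {f} {x} {g} {suc D} {b} (suc M) 0<N terms = begin
  x *ℚ sumQ f (suc b) (b + suc M)                    ≡⟨ cong (λ i → x *ℚ sumQ f (suc b) i) (+-suc b M) ⟩
  x *ℚ sumQ f (suc b) (suc (b + M))                  ≡⟨ cong (x *ℚ_) (sumQ-snoc f (suc b) (b + M) (s≤s (m≤m+n b M))) ⟩
  x *ℚ (sumQ f (suc b) (b + M) +ℚ f (suc (b + M)))   ≡⟨ ℚ.*-distribˡ-+ x (sumQ f (suc b) (b + M)) (f (suc (b + M))) ⟩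
  x *ℚ sumQ f (suc b) (b + M) +ℚ x *ℚ f (suc b + M)  ≡⟨ cong₂ _+ℚ_ IH (terms M ≤-refl) ⟩
  sumBelow g M ÷ℕ suc D +ℚ g M ÷ℕ suc D              ≡⟨ ÷ℕ-+ (sumBelow g M) (g M) D ⟩
  (sumBelow g M + g M) ÷ℕ suc D                      ≡⟨ cong (_÷ℕ suc D) (sumBelow-suc g M) ⟨
  sumBelow g (suc M) ÷ℕ suc D                        ∎
  where
  open ≡-Reasoning
  IH : x *ℚ sumQ f (suc b) (b + M) ≡ sumBelow g M ÷ℕ suc D
  IH = *-sumQ {f} {x} {g} {suc D} {b} M 0<N (λ u u<M → terms u (m<n⇒m<1+n u<M))

÷ℕ-*-÷ℕ : ∀ a {b} c {d} e {f} → 0 < b → 0 < d → 0 < f → a * c * f ≡ e * (b * d) → (a ÷ℕ b) *ℚ (c ÷ℕ d) ≡ e ÷ℕ f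
÷ℕ-*-÷ℕ a {suc b} c {suc d} e {suc f} _ _ _ eq = trans (÷ℕ-* a b c d) (÷ℕ-cross (a * c) (d + b * suc d) e f eq)

count-acceptsAs : ∀ k r d j s n → count (acceptsAs k (suc s) r d j) (arrivalOrders n) ≡ sumBelow (acceptCount k r d j n s) n
count-acceptsAs k r d j s n = begin
  count (acceptsAs k (suc s) r d j) (arrivalOrders n)
    ≡⟨ count≡sumOver _ (arrivalOrders n) ⟩
  sumOver (λ σ → ⟦ acceptsAs k (suc s) r d j σ ⟧) (arrivalOrders n)
    ≡⟨ sumOver-cong (arrivalOrders n) (arrivalOrders-arrangement n) byPosition ⟩
  sumOver (λ σ → sumBelow (λ q → ⟦ acceptedAt k r d j s q σ ⟧) n) (arrivalOrders n)
    ≡⟨ sumOver-sumBelow (λ q σ → ⟦ acceptedAt k r d j s q σ ⟧) n (arrivalOrders n) ⟩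
  sumBelow (λ q → sumOver (λ σ → ⟦ acceptedAt k r d j s q σ ⟧) (arrivalOrders n)) n
    ≡⟨ sumBelow-cong n (λ q _ → count≡sumOver (acceptedAt k r d j s q) (arrivalOrders n)) ⟨
  sumBelow (acceptCount k r d j n s) n ∎
  where
  open ≡-Reasoning
  byPosition : ∀ {σ} → IsArrangement n σ → ⟦ acceptsAs k (suc s) r d j σ ⟧ ≡ sumBelow (λ q → ⟦ acceptedAt k r d j s q σ ⟧) n
  byPosition {σ} (unique , _ , refl) with acceptsAs k (suc s) r d j σ in accepted
  ... | true = sym (occurrences-∈ d σ unique (∈-drop⁻ s σ (acceptsAs⇒∈-drop k s r d j σ accepted)))
  ... | false = sym (trans (sumBelow-const 0 (length σ) (λ _ _ → refl)) (*-zeroʳ (length σ)))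

acceptCount-< : ∀ k r d j n {s q} → q < s → acceptCount k r d j n s q ≡ 0
acceptCount-< k r d j n {s} {q} q<s = trans (count-cong (arrivalOrders n) (arrivalOrders-arrangement n) notBefore) (count-false (arrivalOrders n))
  where
  notBefore : ∀ {σ} → IsArrangement n σ → acceptedAt k r d j s q σ ≡ false
  notBefore {σ} (unique , _) with acceptsAs k (suc s) r d j σ in accepted | is d (nth q σ) in atQ
  ... | true | true = ⊥-elim (<⇒≱ q<s (∈-drop⇒≤-position σ unique (acceptsAs⇒∈-drop k s r d j σ accepted) (is-true d _ atQ)))
  ... | true | false = refl
  ... | false | _ = refl

closedForm-÷ℕ : ∀ r j {n s q} → r + j ≤ q → q < n →
  ((κ r j * fall s r) ÷ℕ n) *ℚ (((q ∸ s) C j) ÷ℕ fall q (r + j)) ≡ closedForm r j n s q ÷ℕ (n !)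
closedForm-÷ℕ r j {suc n} {s} {q} r+j≤q (s≤s q≤n) =
  ÷ℕ-*-÷ℕ K B (K * B * W * P) z<s (fall-pos r+j≤q) (1≤n! (suc n)) (begin
    K * B * (suc n * n !)                ≡⟨ cong (λ m → K * B * (suc n * m)) n!≡ ⟨
    K * B * (suc n * (P * (F * W)))      ≡⟨ regroup K B W P (suc n) F ⟩
    K * B * W * P * (suc n * F)          ∎)
  where
  open ≡-Reasoning
  K = κ r j * fall s r
  B = (q ∸ s) C j
  F = fall q (r + j)
  W = (q ∸ (r + j)) !
  P = fall n (n ∸ q)
  F*W≡q! : F * W ≡ q !
  F*W≡q! = trans (cong (λ m → fall m (r + j) * W) (sym (m∸n+n≡m r+j≤q)))
    (trans (fall-*-! (q ∸ (r + j)) (r + j)) (cong _! (m∸n+n≡m r+j≤q)))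
  n!≡ : P * (F * W) ≡ n !
  n!≡ = trans (cong (P *_) F*W≡q!) (trans (cong (λ m → fall m (n ∸ q) * q !) (sym (m+[n∸m]≡n q≤n)))
    (trans (fall-*-! q (n ∸ q)) (cong _! (m+[n∸m]≡n q≤n))))
  regroup : ∀ K B W P N F → K * B * (N * (P * (F * W))) ≡ K * B * W * P * (N * F)
  regroup = solve-∀

count-acceptsAs≡ : ∀ {k r d j s} M → j < k → 1 ≤ d → d ≤ r → r ≤ s →
  count (acceptsAs k (suc s) r d j) (arrivalOrders (s + j + M)) ≡ sumBelow (λ u → closedForm r j (s + j + M) s (s + j + u)) M
count-acceptsAs≡ {k} {r} {d} {j} {s} M j<k 1≤d d≤r r≤s = begin
  count (acceptsAs k (suc s) r d j) (arrivalOrders n)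
    ≡⟨ count-acceptsAs k r d j s n ⟩
  sumBelow F n
    ≡⟨ sumBelow-+ F (s + j) M ⟩
  sumBelow F (s + j) + sumBelow (λ u → F (s + j + u)) M
    ≡⟨ cong₂ _+_ (trans (sumBelow-const 0 (s + j) beforeWindow) (*-zeroʳ (s + j))) (sumBelow-cong M inWindow) ⟩
  sumBelow (λ u → closedForm r j n s (s + j + u)) M ∎
  where
  open ≡-Reasoning
  n = s + j + M
  F = acceptCount k r d j n s
  beforeWindow : ∀ q → q < s + j → F q ≡ 0
  beforeWindow q q<s+j with q <? s
  ... | yes q<s = acceptCount-< k r d j n q<s
  ... | no q≮s = trans (acceptCount≡closedForm j<k 1≤d d≤r n r≤s (≮⇒≥ q≮s) (<-≤-trans q<s+j (m≤m+n (s + j) M)))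
    (closedForm-< r j n s q (subst (q ∸ s <_) (m+n∸m≡n s j) (∸-monoˡ-< q<s+j (≮⇒≥ q≮s))))
  inWindow : ∀ u → u < M → F (s + j + u) ≡ closedForm r j n s (s + j + u)
  inWindow u u<M = acceptCount≡closedForm j<k 1≤d d≤r n r≤s (≤-trans (m≤m+n s j) (m≤m+n (s + j) u)) (+-monoʳ-< (s + j) u<M)

window-≤ : ∀ {n k s j} → k ≤ s → suc s ≤ n ∸ k → j < k → s + j ≤ n
window-≤ {n} {k} {s} {j} k≤s t≤n-k j<k = ≤-trans (+-monoʳ-≤ s (<⇒≤ j<k)) (≤-trans (n≤1+n (s + k)) (m≤o∸n⇒m+n≤o (suc s) k≤n t≤n-k))
  where
  k≤n : k ≤ n
  k≤n = ≤-trans (≤-trans k≤s (n≤1+n s)) (≤-trans t≤n-k (m∸n≤m n k))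

lemma6 : (n k r t d j : ℕ) →
    1 ≤ n → 1 ≤ k → 1 ≤ r → r ≤ k → k < t → t ≤ n ∸ k →
    1 ≤ d → d ≤ r → j < k →
    prob n k t r d j ≡
    ((fall (r ∸ 1 + j) j * fall (t ∸ 1) r) ÷ℕ n)
    *ℚ sumQ (λ i → ((i ∸ t) C j) ÷ℕ fall (i ∸ 1) (r + j)) (t + j) n
lemma6 n k r (suc s) d j _ _ _ r≤k (s≤s k≤s) t≤n-k 1≤d d≤r j<k = begin
  count (acceptsAs k (suc s) r d j) (arrivalOrders n) ÷ℕ (n !)
    ≡⟨ cong (λ m → count (acceptsAs k (suc s) r d j) (arrivalOrders m) ÷ℕ (m !)) n≡ ⟩
  count (acceptsAs k (suc s) r d j) (arrivalOrders (s + j + M)) ÷ℕ ((s + j + M) !)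
    ≡⟨ cong (_÷ℕ ((s + j + M) !)) (count-acceptsAs≡ M j<k 1≤d d≤r r≤s) ⟩
  sumBelow (λ u → closedForm r j (s + j + M) s (s + j + u)) M ÷ℕ ((s + j + M) !)
    ≡⟨ *-sumQ {f} {c ÷ℕ (s + j + M)} {_} {_} {s + j} M (1≤n! (s + j + M)) term ⟨
  (c ÷ℕ (s + j + M)) *ℚ sumQ f (suc s + j) (s + j + M)
    ≡⟨ cong (λ m → (c ÷ℕ m) *ℚ sumQ f (suc s + j) m) n≡ ⟨
  (c ÷ℕ n) *ℚ sumQ f (suc s + j) n ∎
  where
  open ≡-Reasoning
  c = fall (r ∸ 1 + j) j * fall s r
  f : ℕ → ℚ
  f i = ((i ∸ suc s) C j) ÷ℕ fall (i ∸ 1) (r + j)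
  r≤s : r ≤ s
  r≤s = ≤-trans r≤k k≤s
  M = n ∸ (s + j)
  n≡ : n ≡ s + j + M
  n≡ = sym (m+[n∸m]≡n (window-≤ k≤s t≤n-k j<k))
  term : ∀ u → u < M → (c ÷ℕ (s + j + M)) *ℚ f (suc (s + j + u)) ≡ closedForm r j (s + j + M) s (s + j + u) ÷ℕ ((s + j + M) !)
  term u u<M = closedForm-÷ℕ r j (≤-trans (+-monoˡ-≤ j r≤s) (m≤m+n (s + j) u)) (+-monoʳ-< (s + j) u<M)
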